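{- Let $G_{\mathcal I}$ be the graph constructed below from a $\mathrm{GT}_\le$ instance $\mathcal I$, fix a gadget index $(i,j)\in[\chi]^2$ (and drop the subscript $i,j$), let $h\in\{1,3\}$, let $(a,b)\in S_{i,j}$ and $b'\in[n]$. For $\beta\in[n]$ let $P_\beta$ denote the path consisting of the shortest path from $v^h_{(a,b)}$ to the portal $\rho^h_\beta$, followed by the portal edge $\{\rho^h_\beta,u^h_\beta\}$, followed by the shortest path from $u^h_\beta$ to $u^h_{b'}$. (a) If $b'\ge b$, the shortest path from $v^h_{(a,b)}$ to $u^h_{b'}$ is $P_b$. (b) If $b'<b$, the shortest path from $v^h_{(a,b)}$ to $u^h_{b'}$ is $P_{b'}$.
   Context: Grid Tiling with Inequality ($\mathrm{GT}_\le$): an instance $\mathcal I$ consists of integers $\chi,n$ and sets $S_{i,j}\subseteq[n]^2$ for $(i,j)\in[\chi]^2$; it asks whether one can choose $s_{i,j}\in S_{i,j}$ for all $(i,j)$ such that whenever $s_{i,j}=(a,b)$ and $s_{i+1,j}=(a',b')$ we have $a\le a'$, and whenever $s_{i,j}=(a,b)$ and $s_{i,j+1}=(a',b')$ we have $b\le b'$. Standing assumption: for every $(i,j)$ and every $b\in[n]$ there is $a\in[n]$ with $(a,b)\in S_{i,j}$. Pairs are ordered lexicographically: $(a,b)\le(a',b')$ iff $a<a'$, or $a=a'$ and $b\le b'$. $\boxplus$ denotes addition modulo 4 on $\{1,2,3,4\}$ (so $4\boxplus1=1$). Construction of the edge-weighted graph $G_{\mathcal I}$. For each $(i,j)\in[\chi]^2$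 there is a gadget $G_{i,j}$ (in what follows the subscript $i,j$ is suppressed inside a gadget): a cycle $O_{i,j}$ through four vertices $z^1,z^2,z^3,z^4$ in this cyclic order, where the segment $O^h$ from $z^h$ to $z^{h\boxplus1}$ is a path of total length $2^{n+2}+1/n$. For each $(a,b)\in S_{i,j}$ and $h\in[4]$, the path $O^h$ contains a vertex $v^h_{(a,b)}$ at distance $d_{(a,b)}=2^b-1+a/n$ from $z^h$, and vertices $\psi^h_{(a,b)},\psi'^h_{(a,b)}$ at distance $2^{n+1}$ and $2^{n+1}+1/n$ from $v^h_{(a,b)}$ towards $z^{h\boxplus1}$; $O^h$ is the path through all these points in order of their distance from $z^h$, each edge having length equal to the difference of positions. A central vertex $y$ is joined to each $z^h$ by an edge of length $2^{n+1}+1$. There are four further vertices $x^1,\dots,x^4$. Let $(a^*,b^*)=\min S_{i,j}$ (lexicographic). Add edge $\{x^2,v^2_{(a^*,b^*)}\}$ of length $2^n+2^{b^*}+a^*/n$ and edge $\{x^4,v^4_{(a^*,b^*)}\}$ of length $2^{n+1}+1-2^{b^*}-a^*/n$. For $h\in\{1,3\}$ add a path $U^h=u^h_1u^h_2\cdots u^h_n$ with edge $\{u^h_\lambda,u^h_{\lambda+1}\}$ of length $2^\lambda$, and an edge $\{u^h_n,x^h\}$ of length $2^n$. For $b\in[n]$: the $b$-portal $\rho^1_b$ is $v^1_{(\alpha,b)}$ with $\alpha$ the largest value such that $(\alpha,b)\in S_{i,j}$, joined to $u^1_b$ by a portal edge of length $2^b-\alpha/n$; the $b$-portal $\rho^3_b$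 is $v^3_{(\alpha,b)}$ with $\alpha$ the smallest value such that $(\alpha,b)\in S_{i,j}$, joined to $u^3_b$ by a portal edge of length $2^b-1+\alpha/n$. Gadgets are connected as follows: for $i\in[\chi-1]$, $j\in[\chi]$, a path $P_{i,j}$ from $x^3_{i,j}$ to $x^1_{i+1,j}$ consisting of $n+1$ edges of length $1/(n+1)$; for $i\in[\chi]$, $j\in[\chi-1]$, a path $P'_{i,j}=w_1\cdots w_n$ with $w_1=x^4_{i,j+1}$, $w_n=x^2_{i,j}$ and edge $\{w_\lambda,w_{\lambda+1}\}$ of length $2^\lambda$. -}

module Defs where

open import Data.Nat as ℕ using (ℕ; zero; suc; _^_; _≡ᵇ_)
open import Data.Integer using (+_)
open import Data.Rational using (ℚ; _/_; 0ℚ; _+_; _-_; _≤_)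
open import Data.Bool using (if_then_else_)
open import Data.Product using (Σ; _×_; ∃)
import Data.Sum
import Data.Rational
open import Relation.Binary.PropositionalEquality using (_≡_)
open import Relation.Nullary using (¬_)

⟦_⟧ : ℕ → ℚ
⟦ k ⟧ = + k / 1

-- a / d as a rational (only ever used with d ≥ 1; d = 0 gives 0)
_÷_ : ℕ → ℕ → ℚ
a ÷ zero  = 0ℚ
a ÷ suc d = + a / suc d

InRange : ℕ → ℕ → Set
InRange n k = 1 ℕ.≤ k × k ℕ.≤ n

next : ℕ → ℕ
next 4 = 1
next h = suc h

-- GT≤ instances: S i j a b  means  (a,b) ∈ S_{i,j}

record GTInstance : Set₁ where
  field
    χ : ℕ
    n : ℕ
    S : ℕ → ℕ → ℕ → ℕ → Set

WellFormed : GTInstance → Set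
WellFormed I = ∀ i j a b → InRange χ i → InRange χ j → S i j a b → InRange n a × InRange n b
  where open GTInstance I

StandingAssumption : GTInstance → Set
StandingAssumption I = ∀ i j b → InRange χ i → InRange χ j → InRange n b → ∃ λ a → S i j a b
  where open GTInstance I

-- vertices (each carries the gadget / path index (i,j));
-- terms not corresponding to an actual vertex of G_I are isolated
data V : Set where
  y   : (i j : ℕ) → V
  z   : (i j h : ℕ) → V
  v   : (i j h a b : ℕ) → V
  ψ   : (i j h a b : ℕ) → V
  ψ′  : (i j h a b : ℕ) → V
  x   : (i j h : ℕ) → V
  u   : (i j h λ′ : ℕ) → V
  pv  : (i j k : ℕ) → V
  wv  : (i j k : ℕ) → V

module Graph (I : GTInstance) where
  open GTInstance I

  dpos : ℕ → ℕ → ℚ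
  dpos a b = ⟦ 2 ^ b ⟧ - ⟦ 1 ⟧ + (a ÷ n)

  segLen : ℚ
  segLen = ⟦ 2 ^ (n ℕ.+ 2) ⟧ + (1 ÷ n)

  -- OnO i j h p s : vertex p lies on O^h_{i,j} at distance s from z^h
  data OnO (i j h : ℕ) : V → ℚ → Set where
    onz   : OnO i j h (z i j h) 0ℚ
    onz′  : OnO i j h (z i j (next h)) segLen
    onv   : ∀ {a b} → S i j a b → OnO i j h (v i j h a b) (dpos a b)
    onψ   : ∀ {a b} → S i j a b → OnO i j h (ψ i j h a b) (dpos a b + ⟦ 2 ^ (n ℕ.+ 1) ⟧)
    onψ′  : ∀ {a b} → S i j a b → OnO i j h (ψ′ i j h a b) (dpos a b + ⟦ 2 ^ (n ℕ.+ 1) ⟧ + (1 ÷ n))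

  LexMin : ℕ → ℕ → ℕ → ℕ → Set
  LexMin i j a b = S i j a b × (∀ a′ b′ → S i j a′ b′ → (a ℕ.< a′) Data.Sum.⊎ (a ≡ a′ × b ℕ.≤ b′))

  MaxA : ℕ → ℕ → ℕ → ℕ → Set
  MaxA i j b α = S i j α b × (∀ α′ → S i j α′ b → α′ ℕ.≤ α)

  MinA : ℕ → ℕ → ℕ → ℕ → Set
  MinA i j b α = S i j α b × (∀ α′ → S i j α′ b → α ℕ.≤ α′)

  -- the portal ρ^h_b (h ∈ {1,3}) is v^h_{(α,b)}
  IsPortalA : ℕ → ℕ → ℕ → ℕ → ℕ → Set
  IsPortalA i j h b α = (h ≡ 1 × MaxA i j b α) Data.Sum.⊎ (h ≡ 3 × MinA i j b α)

  portalLen : ℕ → ℕ → ℕ → ℚ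
  portalLen 1 b α = ⟦ 2 ^ b ⟧ - (α ÷ n)
  portalLen _ b α = ⟦ 2 ^ b ⟧ - ⟦ 1 ⟧ + (α ÷ n)

  pnode : ℕ → ℕ → ℕ → V
  pnode i j k = if k ≡ᵇ 0 then x i j 3 else (if k ≡ᵇ suc n then x (suc i) j 1 else pv i j k)

  wnode : ℕ → ℕ → ℕ → V
  wnode i j k = if k ≡ᵇ 1 then x i (suc j) 4 else (if k ≡ᵇ n then x i j 2 else wv i j k)

  data Edge : V → V → ℚ → Set where
    cyc    : ∀ {i j h p q s t} → InRange χ i → InRange χ j → InRange 4 h →
             OnO i j h p s → OnO i j h q t → s ≤ t →
             (∀ r w → OnO i j h r w → ¬ (s Data.Rational.< w × w Data.Rational.< t)) →
             Edge p q (t - s)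
    yz     : ∀ {i j h} → InRange χ i → InRange χ j → InRange 4 h →
             Edge (y i j) (z i j h) (⟦ 2 ^ (n ℕ.+ 1) ⟧ + ⟦ 1 ⟧)
    x2     : ∀ {i j a b} → InRange χ i → InRange χ j → LexMin i j a b →
             Edge (x i j 2) (v i j 2 a b) (⟦ 2 ^ n ⟧ + ⟦ 2 ^ b ⟧ + (a ÷ n))
    x4     : ∀ {i j a b} → InRange χ i → InRange χ j → LexMin i j a b →
             Edge (x i j 4) (v i j 4 a b) (⟦ 2 ^ (n ℕ.+ 1) ⟧ + ⟦ 1 ⟧ - ⟦ 2 ^ b ⟧ - (a ÷ n))
    upath  : ∀ {i j h λ′} → InRange χ i → InRange χ j → (h ≡ 1 Data.Sum.⊎ h ≡ 3) →
             1 ℕ.≤ λ′ → λ′ ℕ.< n →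
             Edge (u i j h λ′) (u i j h (suc λ′)) ⟦ 2 ^ λ′ ⟧
    ux     : ∀ {i j h} → InRange χ i → InRange χ j → (h ≡ 1 Data.Sum.⊎ h ≡ 3) →
             Edge (u i j h n) (x i j h) ⟦ 2 ^ n ⟧
    portal : ∀ {i j h b α} → InRange χ i → InRange χ j → InRange n b →
             IsPortalA i j h b α →
             Edge (v i j h α b) (u i j h b) (portalLen h b α)
    ppath  : ∀ {i j k} → 1 ℕ.≤ i → i ℕ.< χ → InRange χ j → k ℕ.≤ n →
             Edge (pnode i j k) (pnode i j (suc k)) (1 ÷ suc n)
    wpath  : ∀ {i j λ′} → InRange χ i → 1 ℕ.≤ j → j ℕ.< χ → 1 ℕ.≤ λ′ → λ′ ℕ.< n →
             Edge (wnode i j λ′) (wnode i j (suc λ′)) ⟦ 2 ^ λ′ ⟧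
    -- n = 1: P'_{i,j} is the single vertex w_1 = x^4_{i,j+1} = x^2_{i,j};
    -- the identification is modelled by an edge of length 0
    wsame  : ∀ {i j} → InRange χ i → 1 ℕ.≤ j → j ℕ.< χ → n ≡ 1 →
             Edge (x i (suc j) 4) (x i j 2) 0ℚ

  data Walk : V → V → ℚ → Set where
    nil  : ∀ {p} → Walk p p 0ℚ
    step : ∀ {p q t ℓ L} → (Edge p q ℓ Data.Sum.⊎ Edge q p ℓ) → Walk q t L → Walk p t (ℓ + L)

  IsDist : V → V → ℚ → Set
  IsDist p q d = Walk p q d × (∀ L → Walk p q L → d ≤ L)

  -- "P_β is a shortest path from v^h_{(a,b)} to u^h_{b'}":
  -- the length of P_β (shortest v^h_{(a,b)}–ρ^h_β path, portal edge,
  -- shortest u^h_β–u^h_{b'} path) equals the distance from v^h_{(a,b)} to u^h_{b'}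
  PIsShortest : (i j h a b b′ β : ℕ) → Set
  PIsShortest i j h a b b′ β =
    ∀ α d₁ d₃ → IsPortalA i j h β α →
    IsDist (v i j h a b) (v i j h α β) d₁ →
    IsDist (u i j h β) (u i j h b′) d₃ →
    IsDist (v i j h a b) (u i j h b′) (d₁ + portalLen h β α + d₃)

module Submission where

-- An explicit walk along O^h, the portal edge and U^h gives the upper
-- bound.  For the lower bound we build φ : V → ℚ that changes by at most
-- ℓ across every edge of length ℓ, so that every walk from v^h_(a,b) to
-- u^h_b′ is at least φ(v^h_(a,b)) − φ(u^h_b′); this drop is exactly the
-- length of the proposed path.  On side h of the gadget φ(u^h_λ) is the
-- distance |2^λ − 2^b′| along U^h, φ(z^h) = 2^b′ − 1, and φ(v^h_(a,b)) is
-- 2^(b ⊔ b′) − 1 + a/n for h = 3, while for h = 1 it is 2^b′ − a/n if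
-- b ≤ b′ and 2^b + (a − 2α)/n otherwise (α the first coordinate of the
-- b′-portal).  Every other vertex gets 2^n.  All these values are
-- integers over n, so each Lipschitz condition is a linear inequality
-- between natural numbers.

open import Defs
open import Data.Nat as ℕ using (ℕ; zero; suc; _^_; _⊔_; _⊓_; z≤n; s≤s)
import Data.Nat.Properties as ℕP
import Data.Nat.Solver as ℕSolver
import Data.Integer.Properties as ℤP
open import Data.Rational as ℚ using (ℚ; _+_; _-_; _≤_; _<_; 0ℚ; -_)
import Data.Rational.Properties as ℚP
open import Data.Rational.Solver using (module +-*-Solver)
open import Data.Rational.Unnormalised as ℚᵘ using (ℚᵘ; mkℚᵘ; *≡*; *≤*; *<*)
import Data.Rational.Unnormalised.Properties as ℚᵘP
open import Data.Product using (Σ; _×_; _,_; proj₁; proj₂)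
open import Data.Sum using (_⊎_; inj₁; inj₂)
open import Data.Empty using (⊥-elim)
open import Data.Bool using (true; false)
open import Effect.Monad using (RawMonad)
open import Relation.Nullary using (¬_; Dec; yes; no)
open import Relation.Nullary.Negation using (DoubleNegation; ¬¬-Monad; ¬¬-map)
open import Relation.Nullary.Decidable using (_×-dec_; decidable-stable; ¬¬-excluded-middle)
open import Relation.Binary.PropositionalEquality
open import Relation.Binary.Definitions using (tri<; tri≈; tri>)

infix 4 ∣_-_∣≤_

record ∣_-_∣≤_ (r₁ r₂ ℓ : ℚ) : Set where
  constructor _,_
  field
    ≤-left  : r₁ - r₂ ≤ ℓ
    ≤-right : r₂ - r₁ ≤ ℓ

∣r-r∣≤ : ∀ {r ℓ} → 0ℚ ≤ ℓ → ∣ r - r ∣≤ ℓ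
∣r-r∣≤ {r} 0≤ℓ = ≤ℓ , ≤ℓ
  where
  ≤ℓ : r - r ≤ _
  ≤ℓ = subst (_≤ _) (sym (ℚP.+-inverseʳ r)) 0≤ℓ

∣-∣≤-cong : ∀ {r₁ r₂ r₁′ r₂′ ℓ} → r₁ ≡ r₁′ → r₂ ≡ r₂′ → ∣ r₁′ - r₂′ ∣≤ ℓ → ∣ r₁ - r₂ ∣≤ ℓ
∣-∣≤-cong refl refl h = h

∣-∣≤-sym : ∀ {r₁ r₂ ℓ} → ∣ r₁ - r₂ ∣≤ ℓ → ∣ r₂ - r₁ ∣≤ ℓ
∣-∣≤-sym (h₁ , h₂) = h₂ , h₁

∣-∣≤-weaken : ∀ {r₁ r₂ ℓ ℓ′} → ℓ ≤ ℓ′ → ∣ r₁ - r₂ ∣≤ ℓ → ∣ r₁ - r₂ ∣≤ ℓ′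
∣-∣≤-weaken ℓ≤ℓ′ (h₁ , h₂) = ℚP.≤-trans h₁ ℓ≤ℓ′ , ℚP.≤-trans h₂ ℓ≤ℓ′

0≤- : ∀ {s t} → s ≤ t → 0ℚ ≤ t - s
0≤- {s} {t} s≤t = subst (_≤ t - s) (ℚP.+-inverseʳ s) (ℚP.+-monoˡ-≤ (- s) s≤t)

telescope : ∀ s w t → (w - s) + (t - w) ≡ t - s
telescope = solve 3 (λ s w t → (w :- s) :+ (t :- w) := t :- s) refl
  where open +-*-Solver using (solve; _:=_; _:+_; _:-_)

-≤- : ∀ {s t} → s ≤ t → s - t ≤ t - s
-≤- {s} {t} s≤t = ℚP.≤-trans (subst (s - t ≤_) (ℚP.+-inverseʳ t) (ℚP.+-monoˡ-≤ (- t) s≤t)) (0≤- s≤t)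

module SameDenominator (m : ℕ) where
  open import Data.Integer as ℤ using (+_)
  open +-*-Solver using (solve; _:=_; _:+_; _:-_)

  N : ℕ
  N = suc m

  private
    ↑ : ℕ → ℚᵘ
    ↑ a = mkℚᵘ (+ a) m

    fromℚᵘ-homo-+ : ∀ p q → ℚ.fromℚᵘ (p ℚᵘ.+ q) ≡ ℚ.fromℚᵘ p + ℚ.fromℚᵘ q
    fromℚᵘ-homo-+ p q = ℚP.toℚᵘ-injective (ℚᵘP.≃-trans (ℚP.toℚᵘ-fromℚᵘ _)
       (ℚᵘP.≃-sym (ℚᵘP.≃-trans (ℚP.toℚᵘ-homo-+ (ℚ.fromℚᵘ p) (ℚ.fromℚᵘ q))
          (ℚᵘP.+-cong (ℚP.toℚᵘ-fromℚᵘ p) (ℚP.toℚᵘ-fromℚᵘ q)))))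

    toℚᵘ-÷ : ∀ a → ℚ.toℚᵘ (a ÷ N) ℚᵘ.≃ ↑ a
    toℚᵘ-÷ a = ℚP.toℚᵘ-fromℚᵘ (↑ a)

  -- Kept opaque so that the normaliser never unfolds rational arithmetic.
  opaque
    F : ℕ → ℚ
    F a = a ÷ N

    ÷≡F : ∀ a → a ÷ N ≡ F a
    ÷≡F a = refl

    F-homo-+ : ∀ a b → F (a ℕ.+ b) ≡ F a + F b
    F-homo-+ a b = trans (ℚP.fromℚᵘ-cong {↑ (a ℕ.+ b)} {↑ a ℚᵘ.+ ↑ b} (*≡* eq)) (fromℚᵘ-homo-+ (↑ a) (↑ b))
      where
      eq : + (a ℕ.+ b) ℤ.* ℚᵘ.↧ (↑ a ℚᵘ.+ ↑ b) ≡ ℚᵘ.↥ (↑ a ℚᵘ.+ ↑ b) ℤ.* + N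
      eq rewrite ℤP.pos-+ a b | ℤP.pos-* N N =
        trans (sym (ℤP.*-assoc (+ a ℤ.+ + b) (+ N) (+ N)))
          (cong (ℤ._* + N) (ℤP.*-distribʳ-+ (+ N) (+ a) (+ b)))

    F-0 : F 0 ≡ 0ℚ
    F-0 = ℚP.fromℚᵘ-cong {↑ 0} {mkℚᵘ (+ 0) 0} (*≡* refl)

    ⟦⟧≡F : ∀ k → ⟦ k ⟧ ≡ F (k ℕ.* N)
    ⟦⟧≡F k = ℚP.fromℚᵘ-cong {mkℚᵘ (+ k) 0} {↑ (k ℕ.* N)} (*≡* eq)
      where
      eq : + k ℤ.* + N ≡ + (k ℕ.* N) ℤ.* + 1
      eq rewrite ℤP.*-identityʳ (+ (k ℕ.* N)) = sym (ℤP.pos-* k N)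

    F-mono-≤ : ∀ {a b} → a ℕ.≤ b → F a ≤ F b
    F-mono-≤ {a} {b} a≤b = ℚP.toℚᵘ-cancel-≤
      (ℚᵘP.≤-respˡ-≃ (ℚᵘP.≃-sym (toℚᵘ-÷ a)) (ℚᵘP.≤-respʳ-≃ (ℚᵘP.≃-sym (toℚᵘ-÷ b))
        (*≤* (ℤP.*-monoʳ-≤-nonNeg (+ N) (ℤ.+≤+ a≤b)))))

    F-mono-< : ∀ {a b} → a ℕ.< b → F a < F b
    F-mono-< {a} {b} a<b = ℚP.toℚᵘ-cancel-<
      (ℚᵘP.<-respˡ-≃ (ℚᵘP.≃-sym (toℚᵘ-÷ a)) (ℚᵘP.<-respʳ-≃ (ℚᵘP.≃-sym (toℚᵘ-÷ b))
        (*<* (ℤP.*-monoʳ-<-pos (+ N) (ℤ.+<+ a<b)))))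

  -- ⟪ P , Q ⟫ is (P − Q)/N; comparisons of such terms reduce to ℕ.
  ⟪_,_⟫ : ℕ → ℕ → ℚ
  ⟪ P , Q ⟫ = F P - F Q

  ⟪⟫-homo-+ : ∀ a b c d → ⟪ a , b ⟫ + ⟪ c , d ⟫ ≡ ⟪ a ℕ.+ c , b ℕ.+ d ⟫
  ⟪⟫-homo-+ a b c d rewrite F-homo-+ a c | F-homo-+ b d =
    solve 4 (λ A B C D → (A :- B) :+ (C :- D) := (A :+ C) :- (B :+ D)) refl (F a) (F b) (F c) (F d)

  ⟪⟫-homo-- : ∀ a b c d → ⟪ a , b ⟫ - ⟪ c , d ⟫ ≡ ⟪ a ℕ.+ d , b ℕ.+ c ⟫
  ⟪⟫-homo-- a b c d rewrite F-homo-+ a d | F-homo-+ b c =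
    solve 4 (λ A B C D → (A :- B) :- (C :- D) := (A :+ D) :- (B :+ C)) refl (F a) (F b) (F c) (F d)

  ⟦⟧≡⟪⟫ : ∀ k → ⟦ k ⟧ ≡ ⟪ k ℕ.* N , 0 ⟫
  ⟦⟧≡⟪⟫ k rewrite F-0 | ⟦⟧≡F k = sym (ℚP.+-identityʳ _)

  ÷≡⟪⟫ : ∀ a → a ÷ N ≡ ⟪ a , 0 ⟫
  ÷≡⟪⟫ a rewrite F-0 | ÷≡F a = sym (ℚP.+-identityʳ _)

  0ℚ≡⟪⟫ : ∀ P → 0ℚ ≡ ⟪ P , P ⟫
  0ℚ≡⟪⟫ P = sym (ℚP.+-inverseʳ (F P))

  private
    shift : ∀ a b d → F a - F b ≡ (F a + F d) - (F b + F d)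
    shift a b d = solve 3 (λ A B D → A :- B := (A :+ D) :- (B :+ D)) refl (F a) (F b) (F d)

    unshift : ∀ b c d → (F c + F b) - (F b + F d) ≡ F c - F d
    unshift b c d = solve 3 (λ B C D → (C :+ B) :- (B :+ D) := C :- D) refl (F b) (F c) (F d)

  ⟪⟫-mono-≤ : ∀ {a b c d} → a ℕ.+ d ℕ.≤ c ℕ.+ b → ⟪ a , b ⟫ ≤ ⟪ c , d ⟫
  ⟪⟫-mono-≤ {a} {b} {c} {d} h = begin
    F a - F b                  ≡⟨ shift a b d ⟩
    (F a + F d) - (F b + F d)  ≡⟨ cong (_- (F b + F d)) (F-homo-+ a d) ⟨
    F (a ℕ.+ d) - (F b + F d)  ≤⟨ ℚP.+-monoˡ-≤ (- (F b + F d)) (F-mono-≤ h) ⟩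
    F (c ℕ.+ b) - (F b + F d)  ≡⟨ cong (_- (F b + F d)) (F-homo-+ c b) ⟩
    (F c + F b) - (F b + F d)  ≡⟨ unshift b c d ⟩
    F c - F d                  ∎
    where open ℚP.≤-Reasoning

  ⟪⟫-mono-< : ∀ {a b c d} → a ℕ.+ d ℕ.< c ℕ.+ b → ⟪ a , b ⟫ < ⟪ c , d ⟫
  ⟪⟫-mono-< {a} {b} {c} {d} h = begin-strict
    F a - F b                  ≡⟨ shift a b d ⟩
    (F a + F d) - (F b + F d)  ≡⟨ cong (_- (F b + F d)) (F-homo-+ a d) ⟨
    F (a ℕ.+ d) - (F b + F d)  <⟨ ℚP.+-monoˡ-< (- (F b + F d)) (F-mono-< h) ⟩
    F (c ℕ.+ b) - (F b + F d)  ≡⟨ cong (_- (F b + F d)) (F-homo-+ c b) ⟩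
    (F c + F b) - (F b + F d)  ≡⟨ unshift b c d ⟩
    F c - F d                  ∎
    where open ℚP.≤-Reasoning

  ⟪⟫-cancel-≤ : ∀ {a b c d} → ⟪ a , b ⟫ ≤ ⟪ c , d ⟫ → a ℕ.+ d ℕ.≤ c ℕ.+ b
  ⟪⟫-cancel-≤ le = ℕP.≮⇒≥ (λ lt → ℚP.<-irrefl refl (ℚP.<-≤-trans (⟪⟫-mono-< lt) le))

  ⟪⟫-cancel-< : ∀ {a b c d} → ⟪ a , b ⟫ < ⟪ c , d ⟫ → a ℕ.+ d ℕ.< c ℕ.+ b
  ⟪⟫-cancel-< lt = ℕP.≰⇒> (λ le → ℚP.<-irrefl refl (ℚP.<-≤-trans lt (⟪⟫-mono-≤ le)))

  ⟪⟫-cong : ∀ {a b c d} → a ℕ.+ d ≡ c ℕ.+ b → ⟪ a , b ⟫ ≡ ⟪ c , d ⟫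
  ⟪⟫-cong h = ℚP.≤-antisym (⟪⟫-mono-≤ (ℕP.≤-reflexive h)) (⟪⟫-mono-≤ (ℕP.≤-reflexive (sym h)))

  0≤⟪⟫ : ∀ {P Q} → Q ℕ.≤ P → 0ℚ ≤ ⟪ P , Q ⟫
  0≤⟪⟫ {P} {Q} h = subst (_≤ ⟪ P , Q ⟫) (sym (0ℚ≡⟪⟫ 0))
    (⟪⟫-mono-≤ (subst (Q ℕ.≤_) (sym (ℕP.+-identityʳ P)) h))


  ∣-∣≤-by-ℕ : ∀ {r₁ r₂ ℓ : ℚ} (X₁ X₂ Y₁ Y₂ L₁ L₂ : ℕ) →
    r₁ ≡ ⟪ X₁ , X₂ ⟫ → r₂ ≡ ⟪ Y₁ , Y₂ ⟫ → ℓ ≡ ⟪ L₁ , L₂ ⟫ →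
    X₁ ℕ.+ Y₂ ℕ.+ L₂ ℕ.≤ L₁ ℕ.+ (X₂ ℕ.+ Y₁) → Y₁ ℕ.+ X₂ ℕ.+ L₂ ℕ.≤ L₁ ℕ.+ (Y₂ ℕ.+ X₁) → ∣ r₁ - r₂ ∣≤ ℓ
  ∣-∣≤-by-ℕ X₁ X₂ Y₁ Y₂ L₁ L₂ refl refl refl h₁ h₂ = difference≤ X₁ X₂ Y₁ Y₂ h₁ , difference≤ Y₁ Y₂ X₁ X₂ h₂
    where
    difference≤ : ∀ A₁ A₂ B₁ B₂ → A₁ ℕ.+ B₂ ℕ.+ L₂ ℕ.≤ L₁ ℕ.+ (A₂ ℕ.+ B₁) →
      ⟪ A₁ , A₂ ⟫ - ⟪ B₁ , B₂ ⟫ ≤ ⟪ L₁ , L₂ ⟫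
    difference≤ A₁ A₂ B₁ B₂ h = subst (_≤ ⟪ L₁ , L₂ ⟫) (sym (⟪⟫-homo-- A₁ A₂ B₁ B₂)) (⟪⟫-mono-≤ h)

  ∣-∣≤-gap-by-ℕ : ∀ {r₁ r₂ : ℚ} (X₁ X₂ Y₁ Y₂ S T : ℕ) → r₁ ≡ ⟪ X₁ , X₂ ⟫ → r₂ ≡ ⟪ Y₁ , Y₂ ⟫ →
    X₁ ℕ.+ Y₂ ℕ.+ (N ℕ.+ S) ℕ.≤ T ℕ.+ N ℕ.+ (X₂ ℕ.+ Y₁) →
    Y₁ ℕ.+ X₂ ℕ.+ (N ℕ.+ S) ℕ.≤ T ℕ.+ N ℕ.+ (Y₂ ℕ.+ X₁) →
    ∣ r₁ - r₂ ∣≤ ⟪ T , N ⟫ - ⟪ S , N ⟫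
  ∣-∣≤-gap-by-ℕ X₁ X₂ Y₁ Y₂ S T eq₁ eq₂ = ∣-∣≤-by-ℕ X₁ X₂ Y₁ Y₂ (T ℕ.+ N) (N ℕ.+ S) eq₁ eq₂
    (⟪⟫-homo-- T N S N)

module Walks (I : GTInstance) where
  open Graph I

  _++ʷ_ : ∀ {p q r L₁ L₂} → Walk p q L₁ → Walk q r L₂ → Walk p r (L₁ + L₂)
  _++ʷ_ {L₂ = L₂} nil w = subst (Walk _ _) (sym (ℚP.+-identityˡ L₂)) w
  _++ʷ_ {L₂ = L₂} (step {ℓ = ℓ} {L = L} e w) w′ =
    subst (Walk _ _) (sym (ℚP.+-assoc ℓ L L₂)) (step e (w ++ʷ w′))

  edgeʷ : ∀ {p q ℓ} → Edge p q ℓ → Walk p q ℓ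
  edgeʷ {ℓ = ℓ} e = subst (Walk _ _) (ℚP.+-identityʳ ℓ) (step (inj₁ e) nil)

  reverseʷ : ∀ {p q L} → Walk p q L → Walk q p L
  reverseʷ nil = nil
  reverseʷ (step {ℓ = ℓ} {L = L} e w) =
    subst (Walk _ _) (trans (cong (L +_) (ℚP.+-identityʳ ℓ)) (ℚP.+-comm L ℓ))
      (reverseʷ w ++ʷ step (swap e) nil)
    where
    swap : ∀ {p q ℓ} → Edge p q ℓ ⊎ Edge q p ℓ → Edge q p ℓ ⊎ Edge p q ℓ
    swap (inj₁ e) = inj₂ e
    swap (inj₂ e) = inj₁ e

  Lipschitz : (V → ℚ) → Set
  Lipschitz φ = ∀ {p q ℓ} → Edge p q ℓ → ∣ φ p - φ q ∣≤ ℓ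

  Lipschitz⇒drop≤length : ∀ {φ p q L} → Lipschitz φ → Walk p q L → φ p - φ q ≤ L
  Lipschitz⇒drop≤length {φ} {p} lip nil = ℚP.≤-reflexive (ℚP.+-inverseʳ (φ p))
  Lipschitz⇒drop≤length {φ} {p} lip (step {q = q} {t = t} {ℓ = ℓ} {L = L} e w) = begin
    φ p - φ t                  ≡⟨ telescope (φ t) (φ q) (φ p) ⟨
    (φ q - φ t) + (φ p - φ q)  ≤⟨ ℚP.+-mono-≤ (Lipschitz⇒drop≤length lip w) (across e) ⟩
    L + ℓ                      ≡⟨ ℚP.+-comm L ℓ ⟩
    ℓ + L                      ∎
    where
    open ℚP.≤-Reasoning
    across : Edge p q ℓ ⊎ Edge q p ℓ → φ p - φ q ≤ ℓ
    across (inj₁ e) = ∣_-_∣≤_.≤-left (lip e)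
    across (inj₂ e) = ∣_-_∣≤_.≤-right (lip e)

  -- The first walk is only needed under a double negation: it is used
  -- to bound d₁, and the bound is a decidable statement.
  dist-through-edge : ∀ {p ρ u′ q ℓ x₁ x₃ d₁ d₃} (φ : V → ℚ) → Lipschitz φ → Edge ρ u′ ℓ →
    DoubleNegation (Walk p ρ x₁) → Walk u′ q x₃ → x₁ + ℓ + x₃ ≤ φ p - φ q →
    IsDist p ρ d₁ → IsDist u′ q d₃ → IsDist p q (d₁ + ℓ + d₃)
  dist-through-edge {ℓ = ℓ} {x₁} {d₁ = d₁} {d₃} φ lip e X₁ X₃ x≤φ (W₁ , min₁) (W₃ , min₃) = walk , minimal
    where
    walk : Walk _ _ (d₁ + ℓ + d₃)
    walk = subst (Walk _ _) (sym (ℚP.+-assoc d₁ ℓ d₃)) (W₁ ++ʷ step (inj₁ e) W₃)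
    minimal : ∀ L → Walk _ _ L → d₁ + ℓ + d₃ ≤ L
    minimal L W = decidable-stable (d₁ + ℓ + d₃ ℚP.≤? L) (¬¬-map via X₁)
      where
      via : Walk _ _ x₁ → d₁ + ℓ + d₃ ≤ L
      via X₁′ = ℚP.≤-trans (ℚP.+-mono-≤ (ℚP.+-monoˡ-≤ ℓ (min₁ _ X₁′)) (min₃ _ X₃))
        (ℚP.≤-trans x≤φ (Lipschitz⇒drop≤length lip W))

≤-of-≡+ : ∀ {L R} D → R ≡ L ℕ.+ D → L ℕ.≤ R
≤-of-≡+ {L} D refl = ℕP.m≤m+n L D

≤-via-≡+ : ∀ {A R} L → A ℕ.≤ L → ∀ D → R ≡ L ℕ.+ D → A ℕ.≤ R
≤-via-≡+ L A≤L D eq = ℕP.≤-trans A≤L (≤-of-≡+ D eq)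

≤-by-≡ : ∀ {L R} A B → L ≡ A → R ≡ B → A ℕ.≤ B → L ℕ.≤ R
≤-by-≡ A B refl refl A≤B = A≤B

odd≢even : ∀ {h} → h ≡ 1 ⊎ h ≡ 3 → ¬ (h ≡ 2 ⊎ h ≡ 4)
odd≢even (inj₁ refl) (inj₁ ())
odd≢even (inj₁ refl) (inj₂ ())
odd≢even (inj₂ refl) (inj₁ ())
odd≢even (inj₂ refl) (inj₂ ())

next-even : ∀ {h} → h ≡ 1 ⊎ h ≡ 3 → next h ≡ 2 ⊎ next h ≡ 4
next-even (inj₁ refl) = inj₁ refl
next-even (inj₂ refl) = inj₂ refl

module Gadget (χ m : ℕ) (S : ℕ → ℕ → ℕ → ℕ → Set) where
  I : GTInstance
  I = record { χ = χ ; n = suc m ; S = S }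

  open Graph I
  open SameDenominator m
  open Walks I
  open ℕSolver.+-*-Solver using (_:=_; _:+_; _:*_; con) renaming (solve to ℕ-solve)

  e : ℕ → ℕ
  e k = 2 ^ k ℕ.* N

  N≤e : ∀ k → N ℕ.≤ e k
  N≤e k = subst (ℕ._≤ e k) (ℕP.*-identityˡ N) (ℕP.*-monoˡ-≤ N (ℕP.^-monoʳ-≤ 2 (z≤n {k})))

  e-mono-≤ : ∀ {k l} → k ℕ.≤ l → e k ℕ.≤ e l
  e-mono-≤ k≤l = ℕP.*-monoˡ-≤ N (ℕP.^-monoʳ-≤ 2 k≤l)

  e-suc : ∀ k → e (suc k) ≡ e k ℕ.+ e k
  e-suc k = trans (cong (ℕ._* N) (cong (2 ^ k ℕ.+_) (ℕP.+-identityʳ (2 ^ k))))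
    (ℕP.*-distribʳ-+ N (2 ^ k) (2 ^ k))

  e-double-≤ : ∀ {k l} → k ℕ.< l → e k ℕ.+ e k ℕ.≤ e l
  e-double-≤ {k} {l} k<l = subst (ℕ._≤ e l) (e-suc k) (e-mono-≤ k<l)

  N+N≤e : ∀ {k} → 1 ℕ.≤ k → N ℕ.+ N ℕ.≤ e k
  N+N≤e 1≤k = ℕP.≤-trans (ℕP.+-mono-≤ (N≤e 0) (N≤e 0)) (e-double-≤ 1≤k)

  e-N+1 : e (N ℕ.+ 1) ≡ e N ℕ.+ e N
  e-N+1 = trans (cong e (ℕP.+-comm N 1)) (e-suc N)

  e⊔+e⊓ : ∀ b′ β → e (b′ ⊔ β) ℕ.+ e (β ⊓ b′) ≡ e β ℕ.+ e b′
  e⊔+e⊓ b′ β with ℕP.≤-total b′ β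
  ... | inj₁ b′≤β rewrite ℕP.m≤n⇒m⊔n≡n b′≤β | ℕP.m≥n⇒m⊓n≡n b′≤β = refl
  ... | inj₂ β≤b′ rewrite ℕP.m≥n⇒m⊔n≡m β≤b′ | ℕP.m≤n⇒m⊓n≡m β≤b′ = ℕP.+-comm (e b′) (e β)

  e⊔+N≤ : ∀ b′ b → e (b′ ⊔ b) ℕ.+ N ℕ.≤ e b ℕ.+ e b′
  e⊔+N≤ b′ b with ℕP.≤-total b′ b
  ... | inj₁ b′≤b rewrite ℕP.m≤n⇒m⊔n≡n b′≤b = ℕP.+-monoʳ-≤ (e b) (N≤e b′)
  ... | inj₂ b≤b′ rewrite ℕP.m≥n⇒m⊔n≡m b≤b′ =
    subst (ℕ._≤ e b ℕ.+ e b′) (ℕP.+-comm N (e b′)) (ℕP.+-monoˡ-≤ (e b′) (N≤e b))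

  e⊔-increment-≤ : ∀ b′ {b₁ b₂} → b₁ ℕ.≤ b₂ → e (b′ ⊔ b₂) ℕ.+ e b₁ ℕ.≤ e b₂ ℕ.+ e (b′ ⊔ b₁)
  e⊔-increment-≤ b′ {b₁} {b₂} b₁≤b₂ with ℕP.≤-total b′ b₁ | ℕP.≤-total b′ b₂
  ... | inj₁ h₁ | inj₁ h₂ rewrite ℕP.m≤n⇒m⊔n≡n h₁ | ℕP.m≤n⇒m⊔n≡n h₂ = ℕP.≤-refl
  ... | inj₁ h₁ | inj₂ h₂ rewrite ℕP.m≤n⇒m⊔n≡n h₁ | ℕP.m≥n⇒m⊔n≡m h₂ =
    ℕP.+-monoˡ-≤ (e b₁) (e-mono-≤ (ℕP.≤-trans h₁ b₁≤b₂))
  ... | inj₂ h₁ | inj₁ h₂ rewrite ℕP.m≥n⇒m⊔n≡m h₁ | ℕP.m≤n⇒m⊔n≡n h₂ = ℕP.+-monoʳ-≤ (e b₂) (e-mono-≤ h₁)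
  ... | inj₂ h₁ | inj₂ h₂ rewrite ℕP.m≥n⇒m⊔n≡m h₁ | ℕP.m≥n⇒m⊔n≡m h₂ =
    subst (ℕ._≤ e b₂ ℕ.+ e b′) (ℕP.+-comm (e b₁) (e b′)) (ℕP.+-monoˡ-≤ (e b′) (e-mono-≤ b₁≤b₂))

  -- Since a ≤ N < e 1, the numerator e b + a orders [N]² lexicographically by (b, a).
  e+-lex : ∀ {a₁ b₁ a₂ b₂} → InRange N a₂ × InRange N b₂ →
           e b₁ ℕ.+ a₁ ℕ.≤ e b₂ ℕ.+ a₂ → (b₁ ℕ.< b₂) ⊎ (b₁ ≡ b₂ × a₁ ℕ.≤ a₂)
  e+-lex {a₁} {b₁} {a₂} {b₂} ((_ , a₂≤N) , (1≤b₂ , _)) h with ℕP.<-cmp b₁ b₂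
  ... | tri< b₁<b₂ _ _ = inj₁ b₁<b₂
  ... | tri≈ _ refl _ = inj₂ (refl , ℕP.+-cancelˡ-≤ (e b₁) _ _ h)
  ... | tri> _ _ b₂<b₁ = ⊥-elim (ℕP.<⇒≱ (ℕP.<-≤-trans (ℕP.+-monoʳ-< (e b₂) a₂<e) e-gap) h)
    where
    a₂<e : a₂ ℕ.< e b₂
    a₂<e = ℕP.<-≤-trans (ℕP.≤-<-trans a₂≤N (ℕP.m<m+n N (s≤s z≤n))) (N+N≤e 1≤b₂)
    e-gap : e b₂ ℕ.+ e b₂ ℕ.≤ e b₁ ℕ.+ a₁
    e-gap = ℕP.≤-trans (e-double-≤ b₂<b₁) (ℕP.m≤m+n (e b₁) a₁)

  e+a+a≤e : ∀ {a b b₂} → a ℕ.≤ N → 1 ℕ.≤ b → b ℕ.< b₂ → e b ℕ.+ a ℕ.+ a ℕ.≤ e b₂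
  e+a+a≤e {a} {b} {b₂} a≤N 1≤b b<b₂ = begin
    e b ℕ.+ a ℕ.+ a      ≤⟨ ℕP.+-mono-≤ (ℕP.+-monoʳ-≤ (e b) a≤N) a≤N ⟩
    e b ℕ.+ N ℕ.+ N      ≡⟨ ℕP.+-assoc (e b) N N ⟩
    e b ℕ.+ (N ℕ.+ N)    ≤⟨ ℕP.+-monoʳ-≤ (e b) (N+N≤e 1≤b) ⟩
    e b ℕ.+ e b          ≤⟨ e-double-≤ b<b₂ ⟩
    e b₂                 ∎
    where open ℕP.≤-Reasoning

  ⟪⟫+⟦⟧ : ∀ {x P Q} k → x ≡ ⟪ P , Q ⟫ → x + ⟦ k ⟧ ≡ ⟪ P ℕ.+ k ℕ.* N , Q ⟫
  ⟪⟫+⟦⟧ {P = P} {Q} k refl = trans (cong (⟪ P , Q ⟫ +_) (⟦⟧≡⟪⟫ k))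
    (trans (⟪⟫-homo-+ P Q (k ℕ.* N) 0) (cong (λ w → ⟪ P ℕ.+ k ℕ.* N , w ⟫) (ℕP.+-identityʳ Q)))

  ⟪⟫-⟦⟧ : ∀ {x P Q} k → x ≡ ⟪ P , Q ⟫ → x - ⟦ k ⟧ ≡ ⟪ P , Q ℕ.+ k ℕ.* N ⟫
  ⟪⟫-⟦⟧ {P = P} {Q} k refl = trans (cong (λ y → ⟪ P , Q ⟫ - y) (⟦⟧≡⟪⟫ k))
    (trans (⟪⟫-homo-- P Q (k ℕ.* N) 0) (cong (λ w → ⟪ w , Q ℕ.+ k ℕ.* N ⟫) (ℕP.+-identityʳ P)))

  ⟪⟫+÷ : ∀ {x P Q} a → x ≡ ⟪ P , Q ⟫ → x + a ÷ N ≡ ⟪ P ℕ.+ a , Q ⟫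
  ⟪⟫+÷ {P = P} {Q} a refl = trans (cong (⟪ P , Q ⟫ +_) (÷≡⟪⟫ a))
    (trans (⟪⟫-homo-+ P Q a 0) (cong (λ w → ⟪ P ℕ.+ a , w ⟫) (ℕP.+-identityʳ Q)))

  ⟪⟫-÷ : ∀ {x P Q} a → x ≡ ⟪ P , Q ⟫ → x - a ÷ N ≡ ⟪ P , Q ℕ.+ a ⟫
  ⟪⟫-÷ {P = P} {Q} a refl = trans (cong (λ y → ⟪ P , Q ⟫ - y) (÷≡⟪⟫ a))
    (trans (⟪⟫-homo-- P Q a 0) (cong (λ w → ⟪ w , Q ℕ.+ a ⟫) (ℕP.+-identityʳ P)))

  dpos≡⟪⟫ : ∀ a b → dpos a b ≡ ⟪ e b ℕ.+ a , N ⟫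
  dpos≡⟪⟫ a b = trans (⟪⟫+÷ a (⟪⟫-⟦⟧ 1 (⟦⟧≡⟪⟫ (2 ^ b))))
    (⟪⟫-cong (ℕ-solve 3 (λ E a N → E :+ a :+ N := E :+ a :+ (con 0 :+ (N :+ con 0))) refl (e b) a N))

  segLen≡⟪⟫ : segLen ≡ ⟪ e (N ℕ.+ 2) ℕ.+ 1 ℕ.+ N , N ⟫
  segLen≡⟪⟫ = trans (⟪⟫+÷ 1 (⟦⟧≡⟪⟫ (2 ^ (N ℕ.+ 2)))) (⟪⟫-cong (sym (ℕP.+-identityʳ _)))

  ψpos≡⟪⟫ : ∀ a b → dpos a b + ⟦ 2 ^ (N ℕ.+ 1) ⟧ ≡ ⟪ e b ℕ.+ a ℕ.+ e (N ℕ.+ 1) , N ⟫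
  ψpos≡⟪⟫ a b = ⟪⟫+⟦⟧ (2 ^ (N ℕ.+ 1)) (dpos≡⟪⟫ a b)

  ψ′pos≡⟪⟫ : ∀ a b → dpos a b + ⟦ 2 ^ (N ℕ.+ 1) ⟧ + 1 ÷ N ≡ ⟪ e b ℕ.+ a ℕ.+ e (N ℕ.+ 1) ℕ.+ 1 , N ⟫
  ψ′pos≡⟪⟫ a b = ⟪⟫+÷ 1 (ψpos≡⟪⟫ a b)

  portalLen₁≡⟪⟫ : ∀ b α → portalLen 1 b α ≡ ⟪ e b , α ⟫
  portalLen₁≡⟪⟫ b α = ⟪⟫-÷ α (⟦⟧≡⟪⟫ (2 ^ b))

  portalLen₃≡⟪⟫ : ∀ b α → portalLen 3 b α ≡ ⟪ e b ℕ.+ α , N ⟫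
  portalLen₃≡⟪⟫ b α = dpos≡⟪⟫ α b

  onO-position : ∀ {i j h p s} → OnO i j h p s → Σ ℕ λ P → s ≡ ⟪ P , N ⟫
  onO-position onz = N , 0ℚ≡⟪⟫ N
  onO-position onz′ = _ , segLen≡⟪⟫
  onO-position (onv {a} {b} _) = _ , dpos≡⟪⟫ a b
  onO-position (onψ {a} {b} _) = _ , ψpos≡⟪⟫ a b
  onO-position (onψ′ {a} {b} _) = _ , ψ′pos≡⟪⟫ a b

  -- O^h_{i,j} has only finitely many points between two given ones (all
  -- positions are in (1/N)ℕ), but which ones is undecidable for an
  -- arbitrary S; hence the walk is only constructed under ¬¬.
  walk-along-O : ∀ {i j h} → InRange χ i → InRange χ j → InRange 4 h →
    ∀ k {p q s t} P T → OnO i j h p s → OnO i j h q t → s ≡ ⟪ P , N ⟫ → t ≡ ⟪ T , N ⟫ →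
    P ℕ.≤ T → T ℕ.≤ P ℕ.+ k → DoubleNegation (Walk p q (t - s))
  walk-along-O {i} {j} {h} i∈ j∈ h∈ k {p} {q} {s} {t} P T op oq refl refl P≤T T≤P+k = do
    yes (r , w , or , s<w , w<t) ← ¬¬-excluded-middle {A = Between}
      where no none → pure (edgeʷ (cyc i∈ j∈ h∈ op oq s≤t (λ r w or s<w<t → none (r , w , or , s<w<t))))
    through k T≤P+k or (onO-position or) s<w w<t
    where
    open RawMonad ¬¬-Monad
    Between : Set
    Between = Σ V λ r → Σ ℚ λ w → OnO i j h r w × s < w × w < t
    s≤t : s ≤ t
    s≤t = ⟪⟫-mono-≤ (ℕP.+-monoˡ-≤ N P≤T)
    through : ∀ k → T ℕ.≤ P ℕ.+ k → ∀ {r w} → OnO i j h r w → (Σ ℕ λ W → w ≡ ⟪ W , N ⟫) →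
              s < w → w < t → DoubleNegation (Walk p q (t - s))
    through k T≤P+k {r} {w} or (W , refl) s<w w<t =
      split k T≤P+k (ℕP.+-cancelʳ-< N P W (⟪⟫-cancel-< s<w)) (ℕP.+-cancelʳ-< N W T (⟪⟫-cancel-< w<t))
      where
      split : ∀ k → T ℕ.≤ P ℕ.+ k → P ℕ.< W → W ℕ.< T → DoubleNegation (Walk p q (t - s))
      split zero T≤P+0 P<W W<T = ⊥-elim
        (ℕP.<⇒≱ (ℕP.<-trans P<W W<T) (subst (T ℕ.≤_) (ℕP.+-identityʳ P) T≤P+0))
      split (suc k′) T≤P+k P<W W<T = do
        w₁ ← walk-along-O i∈ j∈ h∈ k′ P W op or refl refl (ℕP.<⇒≤ P<W) W≤P+k′
        w₂ ← walk-along-O i∈ j∈ h∈ k′ W T or oq refl refl (ℕP.<⇒≤ W<T) T≤W+k′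
        pure (subst (Walk p q) (telescope s w t) (w₁ ++ʷ w₂))
        where
        W≤P+k′ : W ℕ.≤ P ℕ.+ k′
        W≤P+k′ = ℕP.≤-pred (subst (suc W ℕ.≤_) (ℕP.+-suc P k′) (ℕP.<-≤-trans W<T T≤P+k))
        T≤W+k′ : T ℕ.≤ W ℕ.+ k′
        T≤W+k′ = ℕP.≤-trans T≤P+k (subst (ℕ._≤ W ℕ.+ k′) (sym (ℕP.+-suc P k′)) (ℕP.+-monoˡ-≤ k′ P<W))

  walk-along-U : ∀ {i j h} → InRange χ i → InRange χ j → (h ≡ 1 ⊎ h ≡ 3) →
    ∀ β k → 1 ℕ.≤ β → β ℕ.+ k ℕ.≤ N → Walk (u i j h β) (u i j h (β ℕ.+ k)) ⟪ e (β ℕ.+ k) , e β ⟫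
  walk-along-U i∈ j∈ h∈13 β zero _ _ rewrite ℕP.+-identityʳ β = subst (Walk _ _) (0ℚ≡⟪⟫ (e β)) nil
  walk-along-U i∈ j∈ h∈13 β (suc k) 1≤β β+k<N rewrite ℕP.+-suc β k =
    subst (Walk _ _) first-step+rest
      (step (inj₁ (upath i∈ j∈ h∈13 1≤β (ℕP.<-≤-trans (s≤s (ℕP.m≤m+n β k)) β+k<N)))
            (walk-along-U i∈ j∈ h∈13 (suc β) k (s≤s z≤n) β+k<N))
    where
    E : ℕ
    E = e (suc (β ℕ.+ k))
    first-step+rest : ⟦ 2 ^ β ⟧ + ⟪ E , e (suc β) ⟫ ≡ ⟪ E , e β ⟫
    first-step+rest = trans (cong (_+ ⟪ E , e (suc β) ⟫) (⟦⟧≡⟪⟫ (2 ^ β)))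
      (trans (⟪⟫-homo-+ (e β) 0 E (e (suc β))) (⟪⟫-cong (trans
        (ℕ-solve 2 (λ x E → x :+ E :+ x := E :+ (con 0 :+ (x :+ x))) refl (e β) E)
        (cong (λ y → E ℕ.+ (0 ℕ.+ y)) (sym (e-suc β))))))

  -- The potential for target u^h₀_b′ in gadget (i₀,j₀): g gives its value at the v^h₀_(a,b).
  module Potential (i₀ j₀ h₀ b′ : ℕ) (g : ℕ → ℕ → ℚ) where

    OnSide : ℕ → ℕ → ℕ → Set
    OnSide i j h = i ≡ i₀ × j ≡ j₀ × h ≡ h₀

    onSide? : ∀ i j h → Dec (OnSide i j h)
    onSide? i j h = (i ℕ.≟ i₀) ×-dec ((j ℕ.≟ j₀) ×-dec (h ℕ.≟ h₀))

    far : ℚ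
    far = ⟪ e N , 0 ⟫

    zValue : ℚ
    zValue = ⟪ e b′ , N ⟫

    -- |2^l − 2^b′|, written without truncated subtraction.
    uValue : ℕ → ℚ
    uValue l = ⟪ e l ℕ.+ e b′ , e (l ⊓ b′) ℕ.+ e (l ⊓ b′) ⟫

    select : ∀ {i j h} → Dec (OnSide i j h) → ℚ → ℚ
    select (yes _) r = r
    select (no _) _ = far

    φ : V → ℚ
    φ (z i j h) = select (onSide? i j h) zValue
    φ (v i j h a b) = select (onSide? i j h) (g a b)
    φ (u i j h l) = select (onSide? i j h) (uValue l)
    φ _ = far

    select-on : ∀ {r} → select (onSide? i₀ j₀ h₀) r ≡ r
    select-on with onSide? i₀ j₀ h₀
    ... | yes _ = refl
    ... | no off = ⊥-elim (off (refl , refl , refl))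

    select-off : ∀ {i j h r} → ¬ OnSide i j h → select (onSide? i j h) r ≡ far
    select-off {i} {j} {h} off with onSide? i j h
    ... | yes on = ⊥-elim (off on)
    ... | no _ = refl

    select-either : ∀ {i j h} r → select (onSide? i j h) r ≡ r ⊎ select (onSide? i j h) r ≡ far
    select-either {i} {j} {h} r with onSide? i j h
    ... | yes _ = inj₁ refl
    ... | no _ = inj₂ refl

    φ-pnode : ∀ i j k → φ (pnode i j k) ≡ far
    φ-pnode i j k with k ℕ.≡ᵇ 0
    ... | true = refl
    ... | false with k ℕ.≡ᵇ suc N
    ... | true = refl
    ... | false = refl

    φ-wnode : ∀ i j k → φ (wnode i j k) ≡ far
    φ-wnode i j k with k ℕ.≡ᵇ 1
    ... | true = refl
    ... | false with k ℕ.≡ᵇ N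
    ... | true = refl
    ... | false = refl

    data SidePoint (p : V) (s : ℚ) : Set where
      atZ   : φ p ≡ zValue → s ≡ ⟪ N , N ⟫ → SidePoint p s
      atV   : ∀ a b → S i₀ j₀ a b → φ p ≡ g a b → s ≡ ⟪ e b ℕ.+ a , N ⟫ → SidePoint p s
      atFar : ∀ T → φ p ≡ far → s ≡ ⟪ T , N ⟫ → e N ℕ.+ e N ℕ.+ N ℕ.≤ T → SidePoint p s

    module Lipschitzness
      (h₀∈ : h₀ ≡ 1 ⊎ h₀ ≡ 3) (b′∈ : InRange N b′) (wf : WellFormed I)
      (g-far : ∀ a b T → S i₀ j₀ a b → e N ℕ.+ e N ℕ.+ N ℕ.≤ T →
               ∣ g a b - far ∣≤ ⟪ T , N ⟫ - ⟪ e b ℕ.+ a , N ⟫)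
      (g-z : ∀ a b → S i₀ j₀ a b → ∣ zValue - g a b ∣≤ ⟪ e b ℕ.+ a , N ⟫ - ⟪ N , N ⟫)
      (g-between : ∀ a₁ b₁ a₂ b₂ → S i₀ j₀ a₁ b₁ → S i₀ j₀ a₂ b₂ → e b₁ ℕ.+ a₁ ℕ.≤ e b₂ ℕ.+ a₂ →
                   ∣ g a₁ b₁ - g a₂ b₂ ∣≤ ⟪ e b₂ ℕ.+ a₂ , N ⟫ - ⟪ e b₁ ℕ.+ a₁ , N ⟫)
      (g-portal : ∀ β α → InRange N β → IsPortalA i₀ j₀ h₀ β α → ∣ g α β - uValue β ∣≤ portalLen h₀ β α)
      where

      e-b′≤e-N : e b′ ℕ.≤ e N
      e-b′≤e-N = e-mono-≤ (proj₂ b′∈)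

      ¬OnSide-even : ∀ {i j h} → h ≡ 2 ⊎ h ≡ 4 → ¬ OnSide i j h
      ¬OnSide-even h-even (_ , _ , refl) = odd≢even h₀∈ h-even

      ψ-far : ∀ a b → e N ℕ.+ e N ℕ.+ N ℕ.≤ e b ℕ.+ a ℕ.+ e (N ℕ.+ 1)
      ψ-far a b = subst (ℕ._≤ e b ℕ.+ a ℕ.+ e (N ℕ.+ 1)) (trans (ℕP.+-comm N _) (cong (ℕ._+ N) e-N+1))
        (ℕP.+-monoˡ-≤ (e (N ℕ.+ 1)) (ℕP.≤-trans (N≤e b) (ℕP.m≤m+n _ a)))

      end-far : e N ℕ.+ e N ℕ.+ N ℕ.≤ e (N ℕ.+ 2) ℕ.+ 1 ℕ.+ N
      end-far = subst (λ w → w ℕ.+ N ℕ.≤ e (N ℕ.+ 2) ℕ.+ 1 ℕ.+ N) e-N+1 (ℕP.+-monoˡ-≤ N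
        (ℕP.≤-trans (e-mono-≤ {N ℕ.+ 1} {N ℕ.+ 2} (ℕP.+-monoʳ-≤ N (ℕP.n≤1+n 1))) (ℕP.m≤m+n _ 1)))

      sidePoint : ∀ {p s} → OnO i₀ j₀ h₀ p s → SidePoint p s
      sidePoint onz = atZ select-on (0ℚ≡⟪⟫ N)
      sidePoint onz′ = atFar _ (select-off {i₀} {j₀} (¬OnSide-even (next-even h₀∈))) segLen≡⟪⟫ end-far
      sidePoint (onv {a} {b} ab∈S) = atV a b ab∈S select-on (dpos≡⟪⟫ a b)
      sidePoint (onψ {a} {b} _) = atFar _ refl (ψpos≡⟪⟫ a b) (ψ-far a b)
      sidePoint (onψ′ {a} {b} _) = atFar _ refl (ψ′pos≡⟪⟫ a b) (ℕP.≤-trans (ψ-far a b) (ℕP.m≤m+n _ 1))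

      z-far : ∀ T → e N ℕ.+ e N ℕ.+ N ℕ.≤ T → ∣ zValue - far ∣≤ ⟪ T , N ⟫ - ⟪ N , N ⟫
      z-far T hT = ∣-∣≤-gap-by-ℕ (e b′) N (e N) 0 N T refl refl
        (drop (e b′) (e N) N T e-b′≤e-N hT) (rise (e b′) (e N) N T (N≤e N) hT)
        where
        drop : ∀ Eb EN N T → Eb ℕ.≤ EN → EN ℕ.+ EN ℕ.+ N ℕ.≤ T →
          Eb ℕ.+ 0 ℕ.+ (N ℕ.+ N) ℕ.≤ T ℕ.+ N ℕ.+ (N ℕ.+ EN)
        drop Eb EN N T h1 h2 with ℕP.m≤n⇒∃[o]m+o≡n h1
        ... | k , refl with ℕP.m≤n⇒∃[o]m+o≡n h2
        ... | t , refl =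
          ≤-of-≡+ (Eb ℕ.+ Eb ℕ.+ k ℕ.+ k ℕ.+ k ℕ.+ N ℕ.+ t)
            (ℕ-solve 4 (λ Eb k N t → ((Eb :+ k) :+ (Eb :+ k) :+ N :+ t) :+ N :+ (N :+ (Eb :+ k))
                                  := (Eb :+ con 0 :+ (N :+ N)) :+ (Eb :+ Eb :+ k :+ k :+ k :+ N :+ t))
              refl Eb k N t)
        rise : ∀ Eb EN N T → N ℕ.≤ EN → EN ℕ.+ EN ℕ.+ N ℕ.≤ T →
          EN ℕ.+ N ℕ.+ (N ℕ.+ N) ℕ.≤ T ℕ.+ N ℕ.+ (0 ℕ.+ Eb)
        rise Eb EN N T h1 h2 with ℕP.m≤n⇒∃[o]m+o≡n h1
        ... | k , refl with ℕP.m≤n⇒∃[o]m+o≡n h2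
        ... | t , refl =
          ≤-of-≡+ (k ℕ.+ t ℕ.+ Eb)
            (ℕ-solve 4 (λ N k t Eb → ((N :+ k) :+ (N :+ k) :+ N :+ t) :+ N :+ (con 0 :+ Eb)
                                  := ((N :+ k) :+ N :+ (N :+ N)) :+ (k :+ t :+ Eb))
              refl N k t Eb)

      side-lipschitz : ∀ {p q s t} → SidePoint p s → SidePoint q t → s ≤ t → ∣ φ p - φ q ∣≤ t - s
      side-lipschitz (atZ φ₁ refl) (atZ φ₂ refl) s≤t = ∣-∣≤-cong φ₁ φ₂ (∣r-r∣≤ (0≤- s≤t))
      side-lipschitz (atZ φ₁ refl) (atV a b ab∈S φ₂ refl) s≤t = ∣-∣≤-cong φ₁ φ₂ (g-z a b ab∈S)
      side-lipschitz (atZ φ₁ refl) (atFar T φ₂ refl hT) s≤t = ∣-∣≤-cong φ₁ φ₂ (z-far T hT)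
      side-lipschitz (atV a b ab∈S φ₁ refl) (atZ φ₂ refl) s≤t =
        ∣-∣≤-weaken (-≤- s≤t) (∣-∣≤-sym (∣-∣≤-cong φ₂ φ₁ (g-z a b ab∈S)))
      side-lipschitz (atV a₁ b₁ s₁ φ₁ refl) (atV a₂ b₂ s₂ φ₂ refl) s≤t =
        ∣-∣≤-cong φ₁ φ₂ (g-between a₁ b₁ a₂ b₂ s₁ s₂ (ℕP.+-cancelʳ-≤ N _ _ (⟪⟫-cancel-≤ s≤t)))
      side-lipschitz (atV a b ab∈S φ₁ refl) (atFar T φ₂ refl hT) s≤t = ∣-∣≤-cong φ₁ φ₂ (g-far a b T ab∈S hT)
      side-lipschitz (atFar T φ₁ refl hT) (atZ φ₂ refl) s≤t =
        ∣-∣≤-weaken (-≤- s≤t) (∣-∣≤-sym (∣-∣≤-cong φ₂ φ₁ (z-far T hT)))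
      side-lipschitz (atFar T φ₁ refl hT) (atV a b ab∈S φ₂ refl) s≤t =
        ∣-∣≤-weaken (-≤- s≤t) (∣-∣≤-sym (∣-∣≤-cong φ₂ φ₁ (g-far a b T ab∈S hT)))
      side-lipschitz (atFar _ φ₁ refl _) (atFar _ φ₂ refl _) s≤t = ∣-∣≤-cong φ₁ φ₂ (∣r-r∣≤ (0≤- s≤t))

      e-N+2 : e (N ℕ.+ 2) ≡ e N ℕ.+ e N ℕ.+ (e N ℕ.+ e N)
      e-N+2 = trans (cong e (ℕP.+-suc N 1)) (trans (e-suc (N ℕ.+ 1)) (cong₂ ℕ._+_ e-N+1 e-N+1))

      BeforeEnd : ℕ → Set
      BeforeEnd T = T ℕ.≤ e N ℕ.+ N ℕ.+ e (N ℕ.+ 1) ℕ.+ 1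

      -- A point of a cycle O^h_{i,j} other than O^h₀_{i₀,j₀}: only its end z^{h ⊞ 1}
      -- may carry a potential other than far.
      data OffSidePoint (i j h : ℕ) (p : V) (s : ℚ) : Set where
        offFar : ∀ T → φ p ≡ far → s ≡ ⟪ T , N ⟫ → BeforeEnd T → OffSidePoint i j h p s
        offEnd : p ≡ z i j (next h) → s ≡ ⟪ e (N ℕ.+ 2) ℕ.+ 1 ℕ.+ N , N ⟫ → OffSidePoint i j h p s

      key≤ : ∀ {a b} → a ℕ.≤ N → b ℕ.≤ N → e b ℕ.+ a ℕ.≤ e N ℕ.+ N
      key≤ a≤N b≤N = ℕP.+-mono-≤ (e-mono-≤ b≤N) a≤N

      before-end : ∀ {T} → T ℕ.≤ e N ℕ.+ N → BeforeEnd T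
      before-end T≤ = ℕP.≤-trans T≤ (ℕP.≤-trans (ℕP.m≤m+n _ (e (N ℕ.+ 1))) (ℕP.m≤m+n _ 1))

      ψ-before-end : ∀ {T} → T ℕ.≤ e N ℕ.+ N → BeforeEnd (T ℕ.+ e (N ℕ.+ 1))
      ψ-before-end T≤ = ℕP.≤-trans (ℕP.+-monoˡ-≤ (e (N ℕ.+ 1)) T≤) (ℕP.m≤m+n _ 1)

      ψ′-before-end : ∀ {T} → T ℕ.≤ e N ℕ.+ N → BeforeEnd (T ℕ.+ e (N ℕ.+ 1) ℕ.+ 1)
      ψ′-before-end T≤ = ℕP.+-monoˡ-≤ 1 (ℕP.+-monoˡ-≤ (e (N ℕ.+ 1)) T≤)

      offSidePoint : ∀ {i j h p s} → InRange χ i → InRange χ j → ¬ OnSide i j h → OnO i j h p s →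
                     OffSidePoint i j h p s
      offSidePoint _ _ off onz = offFar N (select-off off) (0ℚ≡⟪⟫ N) (before-end (ℕP.m≤n+m N (e N)))
      offSidePoint _ _ _ onz′ = offEnd refl segLen≡⟪⟫
      offSidePoint {i} {j} i∈ j∈ off (onv {a} {b} ab∈S) with wf i j a b i∈ j∈ ab∈S
      ... | (_ , a≤N) , (_ , b≤N) = offFar _ (select-off off) (dpos≡⟪⟫ a b) (before-end (key≤ a≤N b≤N))
      offSidePoint {i} {j} i∈ j∈ off (onψ {a} {b} ab∈S) with wf i j a b i∈ j∈ ab∈S
      ... | (_ , a≤N) , (_ , b≤N) = offFar _ refl (ψpos≡⟪⟫ a b) (ψ-before-end (key≤ a≤N b≤N))
      offSidePoint {i} {j} i∈ j∈ off (onψ′ {a} {b} ab∈S) with wf i j a b i∈ j∈ ab∈S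
      ... | (_ , a≤N) , (_ , b≤N) = offFar _ refl (ψ′pos≡⟪⟫ a b) (ψ′-before-end (key≤ a≤N b≤N))

      far-end : ∀ T → BeforeEnd T → ∣ far - zValue ∣≤ ⟪ e (N ℕ.+ 2) ℕ.+ 1 ℕ.+ N , N ⟫ - ⟪ T , N ⟫
      far-end T hT = ∣-∣≤-gap-by-ℕ (e N) 0 (e b′) N T (e (N ℕ.+ 2) ℕ.+ 1 ℕ.+ N) refl refl
        (subst (λ w → e N ℕ.+ N ℕ.+ (N ℕ.+ T) ℕ.≤ w ℕ.+ 1 ℕ.+ N ℕ.+ N ℕ.+ (0 ℕ.+ e b′)) (sym e-N+2)
          (drop (e N) (e b′) N T hT′ (N+N≤e (proj₁ b′∈))))
        (subst (λ w → e b′ ℕ.+ 0 ℕ.+ (N ℕ.+ T) ℕ.≤ w ℕ.+ 1 ℕ.+ N ℕ.+ N ℕ.+ (N ℕ.+ e N)) (sym e-N+2)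
          (rise (e N) (e b′) N T hT′ e-b′≤e-N))
        where
        hT′ : T ℕ.≤ e N ℕ.+ N ℕ.+ (e N ℕ.+ e N) ℕ.+ 1
        hT′ = subst (λ w → T ℕ.≤ e N ℕ.+ N ℕ.+ w ℕ.+ 1) e-N+1 hT
        drop : ∀ EN Eb N T → T ℕ.≤ EN ℕ.+ N ℕ.+ (EN ℕ.+ EN) ℕ.+ 1 → N ℕ.+ N ℕ.≤ Eb →
              EN ℕ.+ N ℕ.+ (N ℕ.+ T) ℕ.≤ (EN ℕ.+ EN ℕ.+ (EN ℕ.+ EN)) ℕ.+ 1 ℕ.+ N ℕ.+ N ℕ.+ (0 ℕ.+ Eb)
        drop EN Eb N T h1 h2 with ℕP.m≤n⇒∃[o]m+o≡n h2
        ... | k , refl =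
          ≤-via-≡+ (EN ℕ.+ N ℕ.+ (N ℕ.+ (EN ℕ.+ N ℕ.+ (EN ℕ.+ EN) ℕ.+ 1)))
            (ℕP.+-monoʳ-≤ (EN ℕ.+ N) (ℕP.+-monoʳ-≤ N h1)) (N ℕ.+ k)
            (ℕ-solve 3 (λ EN N k → (EN :+ EN :+ (EN :+ EN)) :+ con 1 :+ N :+ N :+ (con 0 :+ (N :+ N :+ k))
                                := (EN :+ N :+ (N :+ (EN :+ N :+ (EN :+ EN) :+ con 1))) :+ (N :+ k))
              refl EN N k)
        rise : ∀ EN Eb N T → T ℕ.≤ EN ℕ.+ N ℕ.+ (EN ℕ.+ EN) ℕ.+ 1 → Eb ℕ.≤ EN →
              Eb ℕ.+ 0 ℕ.+ (N ℕ.+ T) ℕ.≤ (EN ℕ.+ EN ℕ.+ (EN ℕ.+ EN)) ℕ.+ 1 ℕ.+ N ℕ.+ N ℕ.+ (N ℕ.+ EN)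
        rise EN Eb N T h1 h2 with ℕP.m≤n⇒∃[o]m+o≡n h2
        ... | k , refl =
          ≤-via-≡+ (Eb ℕ.+ 0 ℕ.+ (N ℕ.+ ((Eb ℕ.+ k) ℕ.+ N ℕ.+ ((Eb ℕ.+ k) ℕ.+ (Eb ℕ.+ k)) ℕ.+ 1)))
            (ℕP.+-monoʳ-≤ (Eb ℕ.+ 0) (ℕP.+-monoʳ-≤ N h1)) (Eb ℕ.+ k ℕ.+ k ℕ.+ N)
            (ℕ-solve 3 (λ Eb N k → ((Eb :+ k) :+ (Eb :+ k) :+ ((Eb :+ k) :+ (Eb :+ k))) :+ con 1 :+ N :+ N
                                     :+ (N :+ (Eb :+ k))
                                := (Eb :+ con 0 :+ (N :+ ((Eb :+ k) :+ N :+ ((Eb :+ k) :+ (Eb :+ k)) :+ con 1)))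
                                     :+ (Eb :+ k :+ k :+ N))
              refl Eb N k)

      offSide-lipschitz : ∀ {i j h p q s t} → OffSidePoint i j h p s → OffSidePoint i j h q t → s ≤ t →
                          ∣ φ p - φ q ∣≤ t - s
      offSide-lipschitz (offFar _ φ₁ refl _) (offFar _ φ₂ refl _) s≤t = ∣-∣≤-cong φ₁ φ₂ (∣r-r∣≤ (0≤- s≤t))
      offSide-lipschitz (offEnd refl refl) (offEnd refl refl) s≤t = ∣r-r∣≤ (0≤- s≤t)
      offSide-lipschitz {i} {j} {h} (offFar T φ₁ refl hT) (offEnd refl refl) s≤t
        with select-either {i} {j} {next h} zValue
      ... | inj₁ φ₂ = ∣-∣≤-cong φ₁ φ₂ (far-end T hT)
      ... | inj₂ φ₂ = ∣-∣≤-cong φ₁ φ₂ (∣r-r∣≤ (0≤- s≤t))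
      offSide-lipschitz {i} {j} {h} (offEnd refl refl) (offFar T φ₂ refl hT) s≤t
        with select-either {i} {j} {next h} zValue
      ... | inj₁ φ₁ = ∣-∣≤-weaken (-≤- s≤t) (∣-∣≤-sym (∣-∣≤-cong φ₂ φ₁ (far-end T hT)))
      ... | inj₂ φ₁ = ∣-∣≤-cong φ₁ φ₂ (∣r-r∣≤ (0≤- s≤t))

      cyc-lipschitz : ∀ {i j h p q s t} → InRange χ i → InRange χ j → OnO i j h p s → OnO i j h q t → s ≤ t →
                      ∣ φ p - φ q ∣≤ t - s
      cyc-lipschitz {i} {j} {h} i∈ j∈ op oq s≤t with onSide? i j h
      ... | yes (refl , refl , refl) = side-lipschitz (sidePoint op) (sidePoint oq) s≤t
      ... | no off = offSide-lipschitz (offSidePoint i∈ j∈ off op) (offSidePoint i∈ j∈ off oq) s≤t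

      0≤⟦⟧ : ∀ k → 0ℚ ≤ ⟦ k ⟧
      0≤⟦⟧ k = subst (0ℚ ≤_) (sym (⟦⟧≡⟪⟫ k)) (0≤⟪⟫ z≤n)

      yz-lipschitz : ∀ {i j h} → ∣ far - φ (z i j h) ∣≤ ⟦ 2 ^ (N ℕ.+ 1) ⟧ + ⟦ 1 ⟧
      yz-lipschitz {i} {j} {h} with select-either {i} {j} {h} zValue
      ... | inj₂ φz = ∣-∣≤-cong refl φz (∣r-r∣≤ (subst (0ℚ ≤_) (sym ℓ≡) (0≤⟪⟫ z≤n)))
        where
        ℓ≡ : ⟦ 2 ^ (N ℕ.+ 1) ⟧ + ⟦ 1 ⟧ ≡ ⟪ e (N ℕ.+ 1) ℕ.+ 1 ℕ.* N , 0 ⟫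
        ℓ≡ = ⟪⟫+⟦⟧ 1 (⟦⟧≡⟪⟫ (2 ^ (N ℕ.+ 1)))
      ... | inj₁ φz = ∣-∣≤-cong refl φz
        (∣-∣≤-by-ℕ (e N) 0 (e b′) N (e (N ℕ.+ 1) ℕ.+ 1 ℕ.* N) 0 refl refl (⟪⟫+⟦⟧ 1 (⟦⟧≡⟪⟫ (2 ^ (N ℕ.+ 1))))
          (drop (e N) (e (N ℕ.+ 1)) (e b′) N e-N≤e-N+1)
          (rise (e N) (e (N ℕ.+ 1)) (e b′) N e-b′≤e-N e-N≤e-N+1))
        where
        e-N≤e-N+1 : e N ℕ.≤ e (N ℕ.+ 1)
        e-N≤e-N+1 = e-mono-≤ (ℕP.m≤m+n N 1)
        drop : ∀ EN E1 Eb N → EN ℕ.≤ E1 → EN ℕ.+ N ℕ.+ 0 ℕ.≤ E1 ℕ.+ 1 ℕ.* N ℕ.+ (0 ℕ.+ Eb)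
        drop EN E1 Eb N h with ℕP.m≤n⇒∃[o]m+o≡n h
        ... | k , refl =
          ≤-of-≡+ (k ℕ.+ Eb)
            (ℕ-solve 4 (λ EN k Eb N → (EN :+ k) :+ con 1 :* N :+ (con 0 :+ Eb)
                                   := (EN :+ N :+ con 0) :+ (k :+ Eb))
              refl EN k Eb N)
        rise : ∀ EN E1 Eb N → Eb ℕ.≤ EN → EN ℕ.≤ E1 → Eb ℕ.+ 0 ℕ.+ 0 ℕ.≤ E1 ℕ.+ 1 ℕ.* N ℕ.+ (N ℕ.+ EN)
        rise EN E1 Eb N h1 h2 with ℕP.m≤n⇒∃[o]m+o≡n h1
        ... | k , refl with ℕP.m≤n⇒∃[o]m+o≡n h2
        ... | k2 , refl =
          ≤-of-≡+ (Eb ℕ.+ k ℕ.+ k ℕ.+ k2 ℕ.+ N ℕ.+ N)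
            (ℕ-solve 4 (λ Eb k k2 N → ((Eb :+ k) :+ k2) :+ con 1 :* N :+ (N :+ (Eb :+ k))
                                   := (Eb :+ con 0 :+ con 0) :+ (Eb :+ k :+ k :+ k2 :+ N :+ N))
              refl Eb k k2 N)

      u-step-lipschitz : ∀ l → ∣ uValue l - uValue (suc l) ∣≤ ⟦ 2 ^ l ⟧
      u-step-lipschitz l = ∣-∣≤-by-ℕ _ _ _ _ (e l) 0 refl refl (⟦⟧≡⟪⟫ (2 ^ l)) drop rise
        where
        drop-below : ∀ El Eb →
          El ℕ.+ Eb ℕ.+ ((El ℕ.+ El) ℕ.+ (El ℕ.+ El)) ℕ.+ 0 ℕ.≤ El ℕ.+ (El ℕ.+ El ℕ.+ ((El ℕ.+ El) ℕ.+ Eb))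
        drop-below El Eb =
          ≤-of-≡+ 0
            (ℕ-solve 2 (λ El Eb → El :+ (El :+ El :+ ((El :+ El) :+ Eb))
                               := (El :+ Eb :+ ((El :+ El) :+ (El :+ El)) :+ con 0) :+ con 0)
              refl El Eb)
        drop-above : ∀ El Eb → El ℕ.+ Eb ℕ.+ (Eb ℕ.+ Eb) ℕ.+ 0 ℕ.≤ El ℕ.+ (Eb ℕ.+ Eb ℕ.+ ((El ℕ.+ El) ℕ.+ Eb))
        drop-above El Eb =
          ≤-of-≡+ (El ℕ.+ El)
            (ℕ-solve 2 (λ El Eb → El :+ (Eb :+ Eb :+ ((El :+ El) :+ Eb))
                               := (El :+ Eb :+ (Eb :+ Eb) :+ con 0) :+ (El :+ El))
              refl El Eb)
        rise-below : ∀ El Eb →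
          (El ℕ.+ El) ℕ.+ Eb ℕ.+ (El ℕ.+ El) ℕ.+ 0 ℕ.≤ El ℕ.+ ((El ℕ.+ El) ℕ.+ (El ℕ.+ El) ℕ.+ (El ℕ.+ Eb))
        rise-below El Eb =
          ≤-of-≡+ (El ℕ.+ El)
            (ℕ-solve 2 (λ El Eb → El :+ ((El :+ El) :+ (El :+ El) :+ (El :+ Eb))
                               := ((El :+ El) :+ Eb :+ (El :+ El) :+ con 0) :+ (El :+ El))
              refl El Eb)
        rise-above : ∀ El Eb → (El ℕ.+ El) ℕ.+ Eb ℕ.+ (Eb ℕ.+ Eb) ℕ.+ 0 ℕ.≤ El ℕ.+ (Eb ℕ.+ Eb ℕ.+ (El ℕ.+ Eb))
        rise-above El Eb =
          ≤-of-≡+ 0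
            (ℕ-solve 2 (λ El Eb → El :+ (Eb :+ Eb :+ (El :+ Eb))
                               := ((El :+ El) :+ Eb :+ (Eb :+ Eb) :+ con 0) :+ con 0)
              refl El Eb)

        drop : e l ℕ.+ e b′ ℕ.+ (e (suc l ⊓ b′) ℕ.+ e (suc l ⊓ b′)) ℕ.+ 0 ℕ.≤
               e l ℕ.+ (e (l ⊓ b′) ℕ.+ e (l ⊓ b′) ℕ.+ (e (suc l) ℕ.+ e b′))
        drop with ℕP.<-≤-connex l b′
        ... | inj₁ l<b′ rewrite ℕP.m≤n⇒m⊓n≡m (ℕP.<⇒≤ l<b′) | ℕP.m≤n⇒m⊓n≡m l<b′ | e-suc l =
          drop-below (e l) (e b′)
        ... | inj₂ b′≤l rewrite ℕP.m≥n⇒m⊓n≡n b′≤l | ℕP.m≥n⇒m⊓n≡n (ℕP.m≤n⇒m≤1+n b′≤l) | e-suc l =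
          drop-above (e l) (e b′)
        rise : e (suc l) ℕ.+ e b′ ℕ.+ (e (l ⊓ b′) ℕ.+ e (l ⊓ b′)) ℕ.+ 0 ℕ.≤
               e l ℕ.+ (e (suc l ⊓ b′) ℕ.+ e (suc l ⊓ b′) ℕ.+ (e l ℕ.+ e b′))
        rise with ℕP.<-≤-connex l b′
        ... | inj₁ l<b′ rewrite ℕP.m≤n⇒m⊓n≡m (ℕP.<⇒≤ l<b′) | ℕP.m≤n⇒m⊓n≡m l<b′ | e-suc l =
          rise-below (e l) (e b′)
        ... | inj₂ b′≤l rewrite ℕP.m≥n⇒m⊓n≡n b′≤l | ℕP.m≥n⇒m⊓n≡n (ℕP.m≤n⇒m≤1+n b′≤l) | e-suc l =
          rise-above (e l) (e b′)

      u-x-lipschitz : ∣ uValue N - far ∣≤ ⟦ 2 ^ N ⟧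
      u-x-lipschitz = ∣-∣≤-by-ℕ _ _ _ _ (e N) 0 refl refl (⟦⟧≡⟪⟫ (2 ^ N)) drop rise
        where
        drop′ : ∀ EN Eb → EN ℕ.+ Eb ℕ.+ 0 ℕ.+ 0 ℕ.≤ EN ℕ.+ (Eb ℕ.+ Eb ℕ.+ EN)
        drop′ EN Eb =
          ≤-of-≡+ (Eb ℕ.+ EN)
            (ℕ-solve 2 (λ EN Eb → EN :+ (Eb :+ Eb :+ EN)
                               := (EN :+ Eb :+ con 0 :+ con 0) :+ (Eb :+ EN))
              refl EN Eb)
        rise′ : ∀ EN Eb → Eb ℕ.≤ EN → EN ℕ.+ (Eb ℕ.+ Eb) ℕ.+ 0 ℕ.≤ EN ℕ.+ (0 ℕ.+ (EN ℕ.+ Eb))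
        rise′ EN Eb h with ℕP.m≤n⇒∃[o]m+o≡n h
        ... | k , refl =
          ≤-of-≡+ k
            (ℕ-solve 2 (λ Eb k → (Eb :+ k) :+ (con 0 :+ ((Eb :+ k) :+ Eb))
                              := ((Eb :+ k) :+ (Eb :+ Eb) :+ con 0) :+ k)
              refl Eb k)

        drop : e N ℕ.+ e b′ ℕ.+ 0 ℕ.+ 0 ℕ.≤ e N ℕ.+ (e (N ⊓ b′) ℕ.+ e (N ⊓ b′) ℕ.+ e N)
        drop rewrite ℕP.m≥n⇒m⊓n≡n (proj₂ b′∈) = drop′ (e N) (e b′)
        rise : e N ℕ.+ (e (N ⊓ b′) ℕ.+ e (N ⊓ b′)) ℕ.+ 0 ℕ.≤ e N ℕ.+ (0 ℕ.+ (e N ℕ.+ e b′))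
        rise rewrite ℕP.m≥n⇒m⊓n≡n (proj₂ b′∈) = rise′ (e N) (e b′) e-b′≤e-N

      0≤portalLen : ∀ {i j h b α} → InRange χ i → InRange χ j → IsPortalA i j h b α → 0ℚ ≤ portalLen h b α
      0≤portalLen {i} {j} {b = b} {α} i∈ j∈ (inj₁ (refl , α∈S , _)) =
        subst (0ℚ ≤_) (sym (portalLen₁≡⟪⟫ b α))
          (0≤⟪⟫ (ℕP.≤-trans (proj₂ (proj₁ (wf i j α b i∈ j∈ α∈S))) (N≤e b)))
      0≤portalLen {b = b} {α} i∈ j∈ (inj₂ (refl , α∈S , _)) =
        subst (0ℚ ≤_) (sym (portalLen₃≡⟪⟫ b α)) (0≤⟪⟫ (ℕP.≤-trans (N≤e b) (ℕP.m≤m+n _ α)))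

      0≤x2-length : ∀ b a → 0ℚ ≤ ⟦ 2 ^ N ⟧ + ⟦ 2 ^ b ⟧ + a ÷ N
      0≤x2-length b a = subst (0ℚ ≤_) (sym (⟪⟫+÷ a (⟪⟫+⟦⟧ (2 ^ b) (⟦⟧≡⟪⟫ (2 ^ N))))) (0≤⟪⟫ z≤n)

      0≤x4-length : ∀ b a → b ℕ.≤ N → a ℕ.≤ N → 0ℚ ≤ ⟦ 2 ^ (N ℕ.+ 1) ⟧ + ⟦ 1 ⟧ - ⟦ 2 ^ b ⟧ - a ÷ N
      0≤x4-length b a b≤N a≤N =
        subst (0ℚ ≤_) (sym (⟪⟫-÷ a (⟪⟫-⟦⟧ (2 ^ b) (⟪⟫+⟦⟧ 1 (⟦⟧≡⟪⟫ (2 ^ (N ℕ.+ 1)))))))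
          (0≤⟪⟫ (ℕP.+-mono-≤ (ℕP.≤-trans (e-mono-≤ b≤N) (e-mono-≤ (ℕP.m≤m+n N 1)))
                              (subst (a ℕ.≤_) (sym (ℕP.*-identityˡ N)) a≤N)))

      0≤1/n : 0ℚ ≤ 1 ÷ suc N
      0≤1/n = subst (0ℚ ≤_) (sym (SameDenominator.÷≡⟪⟫ (suc m) 1)) (SameDenominator.0≤⟪⟫ (suc m) z≤n)

      lipschitz : Lipschitz φ
      lipschitz (cyc i∈ j∈ _ op oq s≤t _) = cyc-lipschitz i∈ j∈ op oq s≤t
      lipschitz (yz {i} {j} {h} _ _ _) = yz-lipschitz {i} {j} {h}
      lipschitz (x2 {i} {j} {a} {b} _ _ _) = ∣-∣≤-cong refl (select-off {i} {j} (¬OnSide-even (inj₁ refl)))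
        (∣r-r∣≤ (0≤x2-length b a))
      lipschitz (x4 {i} {j} {a} {b} i∈ j∈ (ab∈S , _)) with wf i j a b i∈ j∈ ab∈S
      ... | (_ , a≤N) , (_ , b≤N) = ∣-∣≤-cong refl (select-off {i} {j} (¬OnSide-even (inj₂ refl)))
        (∣r-r∣≤ (0≤x4-length b a b≤N a≤N))
      lipschitz (upath {i} {j} {h} {l} _ _ _ _ _) with onSide? i j h
      ... | yes _ = u-step-lipschitz l
      ... | no _ = ∣r-r∣≤ (0≤⟦⟧ (2 ^ l))
      lipschitz (ux {i} {j} {h} _ _ _) with onSide? i j h
      ... | yes _ = u-x-lipschitz
      ... | no _ = ∣r-r∣≤ (0≤⟦⟧ (2 ^ N))
      lipschitz (portal {i} {j} {h} {b} {α} i∈ j∈ b∈ port) with onSide? i j h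
      ... | yes (refl , refl , refl) = g-portal b α b∈ port
      ... | no _ = ∣r-r∣≤ (0≤portalLen i∈ j∈ port)
      lipschitz (ppath {i} {j} {k} _ _ _ _) = ∣-∣≤-cong (φ-pnode i j k) (φ-pnode i j (suc k)) (∣r-r∣≤ 0≤1/n)
      lipschitz (wpath {i} {j} {l} _ _ _ _ _) = ∣-∣≤-cong (φ-wnode i j l) (φ-wnode i j (suc l))
        (∣r-r∣≤ (0≤⟦⟧ (2 ^ l)))
      lipschitz (wsame _ _ _ _) = ∣r-r∣≤ ℚP.≤-refl

  walk-between-v : ∀ {i j h a₁ b₁ a₂ b₂} → InRange χ i → InRange χ j → InRange 4 h →
    S i j a₁ b₁ → S i j a₂ b₂ → e b₁ ℕ.+ a₁ ℕ.≤ e b₂ ℕ.+ a₂ →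
    DoubleNegation (Walk (v i j h a₁ b₁) (v i j h a₂ b₂) (dpos a₂ b₂ - dpos a₁ b₁))
  walk-between-v {a₁ = a₁} {b₁} {a₂} {b₂} i∈ j∈ h∈ s₁ s₂ key₁≤key₂ =
    walk-along-O i∈ j∈ h∈ (e b₂ ℕ.+ a₂) (e b₁ ℕ.+ a₁) (e b₂ ℕ.+ a₂) (onv s₁) (onv s₂)
      (dpos≡⟪⟫ a₁ b₁) (dpos≡⟪⟫ a₂ b₂) key₁≤key₂ (ℕP.m≤n+m (e b₂ ℕ.+ a₂) (e b₁ ℕ.+ a₁))

  walk-up-U : ∀ {i j h β b′} → InRange χ i → InRange χ j → (h ≡ 1 ⊎ h ≡ 3) →
    1 ℕ.≤ β → β ℕ.≤ b′ → b′ ℕ.≤ N → Walk (u i j h β) (u i j h b′) ⟪ e b′ , e β ⟫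
  walk-up-U {i} {j} {h} {β} i∈ j∈ h∈13 1≤β β≤b′ b′≤N with ℕP.m≤n⇒∃[o]m+o≡n β≤b′
  ... | k , refl = walk-along-U i∈ j∈ h∈13 β k 1≤β b′≤N

  ⟪⟫-difference : ∀ {r₁ r₂ A B C D} → r₁ ≡ ⟪ A , B ⟫ → r₂ ≡ ⟪ C , D ⟫ → r₁ - r₂ ≡ ⟪ A ℕ.+ D , B ℕ.+ C ⟫
  ⟪⟫-difference {A = A} {B} {C} {D} refl refl = ⟪⟫-homo-- A B C D

  ⟪⟫-sum₃ : ∀ {r₁ r₂ r₃ A₁ B₁ A₂ B₂ A₃ B₃} → r₁ ≡ ⟪ A₁ , B₁ ⟫ → r₂ ≡ ⟪ A₂ , B₂ ⟫ → r₃ ≡ ⟪ A₃ , B₃ ⟫ →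
    r₁ + r₂ + r₃ ≡ ⟪ A₁ ℕ.+ A₂ ℕ.+ A₃ , B₁ ℕ.+ B₂ ℕ.+ B₃ ⟫
  ⟪⟫-sum₃ {A₁ = A₁} {B₁} {A₂} {B₂} {A₃} {B₃} refl refl refl =
    trans (cong (_+ ⟪ A₃ , B₃ ⟫) (⟪⟫-homo-+ A₁ B₁ A₂ B₂)) (⟪⟫-homo-+ _ _ A₃ B₃)

  1∈[4] : InRange 4 1
  1∈[4] = s≤s z≤n , s≤s z≤n

  3∈[4] : InRange 4 3
  3∈[4] = s≤s z≤n , s≤s (s≤s (s≤s z≤n))

  module Side3 (i₀ j₀ b′ : ℕ) (b′∈ : InRange N b′) (wf : WellFormed I)
               (i∈ : InRange χ i₀) (j∈ : InRange χ j₀) where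

    inRange : ∀ a b → S i₀ j₀ a b → InRange N a × InRange N b
    inRange a b ab∈S = wf i₀ j₀ a b i∈ j∈ ab∈S

    g₃ : ℕ → ℕ → ℚ
    g₃ a b = ⟪ e (b′ ⊔ b) ℕ.+ a , N ⟫

    open Potential i₀ j₀ 3 b′ g₃ public

    g-far : ∀ a b T → S i₀ j₀ a b → e N ℕ.+ e N ℕ.+ N ℕ.≤ T →
            ∣ g₃ a b - far ∣≤ ⟪ T , N ⟫ - ⟪ e b ℕ.+ a , N ⟫
    g-far a b T ab∈S hT with inRange a b ab∈S
    ... | (_ , a≤N) , (_ , b≤N) =
      ∣-∣≤-gap-by-ℕ (e (b′ ⊔ b) ℕ.+ a) N (e N) 0 (e b ℕ.+ a) T refl refl
        (drop (e (b′ ⊔ b)) (e b) (e N) a N T (e-mono-≤ (ℕP.⊔-lub (proj₂ b′∈) b≤N)) (e-mono-≤ b≤N) a≤N hT)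
        (rise (e (b′ ⊔ b)) (e b) (e N) a N T (e-mono-≤ b≤N) hT)
      where
      drop : ∀ Eu Eb EN a N T → Eu ℕ.≤ EN → Eb ℕ.≤ EN → a ℕ.≤ N → EN ℕ.+ EN ℕ.+ N ℕ.≤ T →
              (Eu ℕ.+ a) ℕ.+ 0 ℕ.+ (N ℕ.+ (Eb ℕ.+ a)) ℕ.≤ T ℕ.+ N ℕ.+ (N ℕ.+ EN)
      drop Eu Eb EN a N T hu hb ha hT with ℕP.m≤n⇒∃[o]m+o≡n hT
      ... | t , refl =
        ≤-via-≡+ ((EN ℕ.+ N) ℕ.+ 0 ℕ.+ (N ℕ.+ (EN ℕ.+ N)))
          (ℕP.+-mono-≤ (ℕP.+-monoˡ-≤ 0 (ℕP.+-mono-≤ hu ha)) (ℕP.+-monoʳ-≤ N (ℕP.+-mono-≤ hb ha))) (EN ℕ.+ t)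
          (ℕ-solve 3 (λ EN N t → (EN :+ EN :+ N :+ t) :+ N :+ (N :+ EN)
                              := ((EN :+ N) :+ con 0 :+ (N :+ (EN :+ N))) :+ (EN :+ t))
            refl EN N t)
      rise : ∀ Eu Eb EN a N T → Eb ℕ.≤ EN → EN ℕ.+ EN ℕ.+ N ℕ.≤ T →
              EN ℕ.+ N ℕ.+ (N ℕ.+ (Eb ℕ.+ a)) ℕ.≤ T ℕ.+ N ℕ.+ (0 ℕ.+ (Eu ℕ.+ a))
      rise Eu Eb EN a N T hb hT with ℕP.m≤n⇒∃[o]m+o≡n hT
      ... | t , refl =
        ≤-via-≡+ (EN ℕ.+ N ℕ.+ (N ℕ.+ (EN ℕ.+ a)))
          (ℕP.+-monoʳ-≤ (EN ℕ.+ N) (ℕP.+-monoʳ-≤ N (ℕP.+-monoˡ-≤ a hb))) (t ℕ.+ Eu)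
          (ℕ-solve 5 (λ EN N t Eu a → (EN :+ EN :+ N :+ t) :+ N :+ (con 0 :+ (Eu :+ a))
                                   := (EN :+ N :+ (N :+ (EN :+ a))) :+ (t :+ Eu))
            refl EN N t Eu a)

    g-z : ∀ a b → S i₀ j₀ a b → ∣ zValue - g₃ a b ∣≤ ⟪ e b ℕ.+ a , N ⟫ - ⟪ N , N ⟫
    g-z a b ab∈S =
      ∣-∣≤-gap-by-ℕ (e b′) N (e (b′ ⊔ b) ℕ.+ a) N N (e b ℕ.+ a) refl refl
        (drop (e b′) (e (b′ ⊔ b)) (e b) a N (e-mono-≤ (ℕP.m≤m⊔n b′ b)) (N≤e b))
        (rise (e b′) (e (b′ ⊔ b)) (e b) a N (e⊔+N≤ b′ b))
      where
      drop : ∀ Eb′ Eu Eb a N → Eb′ ℕ.≤ Eu → N ℕ.≤ Eb →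
        Eb′ ℕ.+ N ℕ.+ (N ℕ.+ N) ℕ.≤ Eb ℕ.+ a ℕ.+ N ℕ.+ (N ℕ.+ (Eu ℕ.+ a))
      drop Eb′ Eu Eb a N h1 h2 with ℕP.m≤n⇒∃[o]m+o≡n h1 | ℕP.m≤n⇒∃[o]m+o≡n h2
      ... | k1 , refl | k2 , refl =
        ≤-of-≡+ (k1 ℕ.+ k2 ℕ.+ a ℕ.+ a)
          (ℕ-solve 5 (λ Eb′ k1 N k2 a → (N :+ k2) :+ a :+ N :+ (N :+ ((Eb′ :+ k1) :+ a))
                                     := (Eb′ :+ N :+ (N :+ N)) :+ (k1 :+ k2 :+ a :+ a))
            refl Eb′ k1 N k2 a)
      rise : ∀ Eb′ Eu Eb a N → Eu ℕ.+ N ℕ.≤ Eb ℕ.+ Eb′ →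
        Eu ℕ.+ a ℕ.+ N ℕ.+ (N ℕ.+ N) ℕ.≤ Eb ℕ.+ a ℕ.+ N ℕ.+ (N ℕ.+ Eb′)
      rise Eb′ Eu Eb a N h =
        ≤-by-≡ ((Eu ℕ.+ N) ℕ.+ (a ℕ.+ N ℕ.+ N)) ((Eb ℕ.+ Eb′) ℕ.+ (a ℕ.+ N ℕ.+ N))
          (ℕ-solve 5 (λ Eb′ Eu Eb a N → Eu :+ a :+ N :+ (N :+ N)
                                     := (Eu :+ N) :+ (a :+ N :+ N))
            refl Eb′ Eu Eb a N)
          (ℕ-solve 5 (λ Eb′ Eu Eb a N → Eb :+ a :+ N :+ (N :+ Eb′)
                                     := (Eb :+ Eb′) :+ (a :+ N :+ N))
            refl Eb′ Eu Eb a N)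
          (ℕP.+-monoˡ-≤ _ h)

    g-between : ∀ a₁ b₁ a₂ b₂ → S i₀ j₀ a₁ b₁ → S i₀ j₀ a₂ b₂ → e b₁ ℕ.+ a₁ ℕ.≤ e b₂ ℕ.+ a₂ →
                ∣ g₃ a₁ b₁ - g₃ a₂ b₂ ∣≤ ⟪ e b₂ ℕ.+ a₂ , N ⟫ - ⟪ e b₁ ℕ.+ a₁ , N ⟫
    g-between a₁ b₁ a₂ b₂ s₁ s₂ key₁≤key₂ =
      ∣-∣≤-gap-by-ℕ (e (b′ ⊔ b₁) ℕ.+ a₁) N (e (b′ ⊔ b₂) ℕ.+ a₂) N (e b₁ ℕ.+ a₁) (e b₂ ℕ.+ a₂) refl refl
        (drop (e (b′ ⊔ b₁)) (e b₁) a₁ (e (b′ ⊔ b₂)) (e b₂) a₂ N (keys≤ lex))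
        (rise (e (b′ ⊔ b₁)) (e b₁) a₁ (e (b′ ⊔ b₂)) (e b₂) a₂ N (e⊔-increment-≤ b′ (b≤ lex)))
      where
      r₁ : InRange N a₁ × InRange N b₁
      r₁ = inRange a₁ b₁ s₁
      lex : (b₁ ℕ.< b₂) ⊎ (b₁ ≡ b₂ × a₁ ℕ.≤ a₂)
      lex = e+-lex (inRange a₂ b₂ s₂) key₁≤key₂
      b≤ : (b₁ ℕ.< b₂) ⊎ (b₁ ≡ b₂ × a₁ ℕ.≤ a₂) → b₁ ℕ.≤ b₂
      b≤ (inj₁ b₁<b₂) = ℕP.<⇒≤ b₁<b₂
      b≤ (inj₂ (refl , _)) = ℕP.≤-refl
      lower-b : ∀ Eb1 Eb2 Eu1 Eu2 a1 a2 N →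
        a1 ℕ.≤ N → N ℕ.+ N ℕ.≤ Eb1 → Eb1 ℕ.+ Eb1 ℕ.≤ Eb2 → Eu1 ℕ.≤ Eu2 →
        (Eb1 ℕ.+ a1) ℕ.+ (Eu1 ℕ.+ a1) ℕ.≤ (Eb2 ℕ.+ a2) ℕ.+ (Eu2 ℕ.+ a2)
      lower-b Eb1 Eb2 Eu1 Eu2 a1 a2 N h1 h2 h3 h4 =
        ≤-by-≡ ((Eb1 ℕ.+ (a1 ℕ.+ a1)) ℕ.+ Eu1) ((Eb2 ℕ.+ a2) ℕ.+ (Eu2 ℕ.+ a2))
          (ℕ-solve 3 (λ Eb1 a1 Eu1 → (Eb1 :+ a1) :+ (Eu1 :+ a1)
                                  := (Eb1 :+ (a1 :+ a1)) :+ Eu1)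
            refl Eb1 a1 Eu1)
          refl
          (ℕP.≤-trans (ℕP.+-mono-≤ (ℕP.≤-trans (ℕP.+-monoʳ-≤ Eb1 (ℕP.≤-trans (ℕP.+-mono-≤ h1 h1) h2)) h3) h4)
            (ℕP.+-mono-≤ (ℕP.m≤m+n Eb2 a2) (ℕP.m≤m+n Eu2 a2)))
      keys≤ : (b₁ ℕ.< b₂) ⊎ (b₁ ≡ b₂ × a₁ ℕ.≤ a₂) →
              (e b₁ ℕ.+ a₁) ℕ.+ (e (b′ ⊔ b₁) ℕ.+ a₁) ℕ.≤ (e b₂ ℕ.+ a₂) ℕ.+ (e (b′ ⊔ b₂) ℕ.+ a₂)
      keys≤ (inj₁ b₁<b₂) = lower-b (e b₁) (e b₂) (e (b′ ⊔ b₁)) (e (b′ ⊔ b₂)) a₁ a₂ N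
        (proj₂ (proj₁ r₁)) (N+N≤e (proj₁ (proj₂ r₁))) (e-double-≤ b₁<b₂)
        (e-mono-≤ (ℕP.⊔-monoʳ-≤ b′ (ℕP.<⇒≤ b₁<b₂)))
      keys≤ (inj₂ (refl , a₁≤a₂)) = ℕP.+-mono-≤ (ℕP.+-monoʳ-≤ (e b₁) a₁≤a₂) (ℕP.+-monoʳ-≤ (e (b′ ⊔ b₁)) a₁≤a₂)
      drop : ∀ Eu1 Eb1 a1 Eu2 Eb2 a2 N → (Eb1 ℕ.+ a1) ℕ.+ (Eu1 ℕ.+ a1) ℕ.≤ (Eb2 ℕ.+ a2) ℕ.+ (Eu2 ℕ.+ a2) →
              (Eu1 ℕ.+ a1) ℕ.+ N ℕ.+ (N ℕ.+ (Eb1 ℕ.+ a1)) ℕ.≤ Eb2 ℕ.+ a2 ℕ.+ N ℕ.+ (N ℕ.+ (Eu2 ℕ.+ a2))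
      drop Eu1 Eb1 a1 Eu2 Eb2 a2 N h =
        ≤-by-≡ (((Eb1 ℕ.+ a1) ℕ.+ (Eu1 ℕ.+ a1)) ℕ.+ (N ℕ.+ N))
          (((Eb2 ℕ.+ a2) ℕ.+ (Eu2 ℕ.+ a2)) ℕ.+ (N ℕ.+ N))
          (ℕ-solve 7 (λ Eu1 Eb1 a1 Eu2 Eb2 a2 N → (Eu1 :+ a1) :+ N :+ (N :+ (Eb1 :+ a1))
                                               := ((Eb1 :+ a1) :+ (Eu1 :+ a1)) :+ (N :+ N))
            refl Eu1 Eb1 a1 Eu2 Eb2 a2 N)
          (ℕ-solve 7 (λ Eu1 Eb1 a1 Eu2 Eb2 a2 N → Eb2 :+ a2 :+ N :+ (N :+ (Eu2 :+ a2))
                                               := ((Eb2 :+ a2) :+ (Eu2 :+ a2)) :+ (N :+ N))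
            refl Eu1 Eb1 a1 Eu2 Eb2 a2 N)
          (ℕP.+-monoˡ-≤ _ h)
      rise : ∀ Eu1 Eb1 a1 Eu2 Eb2 a2 N → Eu2 ℕ.+ Eb1 ℕ.≤ Eb2 ℕ.+ Eu1 →
              (Eu2 ℕ.+ a2) ℕ.+ N ℕ.+ (N ℕ.+ (Eb1 ℕ.+ a1)) ℕ.≤ Eb2 ℕ.+ a2 ℕ.+ N ℕ.+ (N ℕ.+ (Eu1 ℕ.+ a1))
      rise Eu1 Eb1 a1 Eu2 Eb2 a2 N h =
        ≤-by-≡ ((Eu2 ℕ.+ Eb1) ℕ.+ (a1 ℕ.+ a2 ℕ.+ N ℕ.+ N))
          ((Eb2 ℕ.+ Eu1) ℕ.+ (a1 ℕ.+ a2 ℕ.+ N ℕ.+ N))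
          (ℕ-solve 7 (λ Eu1 Eb1 a1 Eu2 Eb2 a2 N → (Eu2 :+ a2) :+ N :+ (N :+ (Eb1 :+ a1))
                                               := (Eu2 :+ Eb1) :+ (a1 :+ a2 :+ N :+ N))
            refl Eu1 Eb1 a1 Eu2 Eb2 a2 N)
          (ℕ-solve 7 (λ Eu1 Eb1 a1 Eu2 Eb2 a2 N → Eb2 :+ a2 :+ N :+ (N :+ (Eu1 :+ a1))
                                               := (Eb2 :+ Eu1) :+ (a1 :+ a2 :+ N :+ N))
            refl Eu1 Eb1 a1 Eu2 Eb2 a2 N)
          (ℕP.+-monoˡ-≤ _ h)

    g-portal : ∀ β α → InRange N β → IsPortalA i₀ j₀ 3 β α → ∣ g₃ α β - uValue β ∣≤ portalLen 3 β α
    g-portal β α _ _ =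
      ∣-∣≤-by-ℕ (e (b′ ⊔ β) ℕ.+ α) N (e β ℕ.+ e b′) (e (β ⊓ b′) ℕ.+ e (β ⊓ b′)) (e β ℕ.+ α) N
        refl refl (portalLen₃≡⟪⟫ β α)
        (drop (e (b′ ⊔ β)) (e (β ⊓ b′)) (e β) (e b′) α N (e⊔+e⊓ b′ β) (e-mono-≤ (ℕP.m⊓n≤m β b′)))
        (rise (e (b′ ⊔ β)) (e (β ⊓ b′)) (e β) (e b′) α N (e-mono-≤ (ℕP.m≤m⊔n b′ β)) (N≤e (β ⊓ b′)))
      where
      drop : ∀ Eu El Eβ Eb′ α N → Eu ℕ.+ El ≡ Eβ ℕ.+ Eb′ → El ℕ.≤ Eβ →
              (Eu ℕ.+ α) ℕ.+ (El ℕ.+ El) ℕ.+ N ℕ.≤ Eβ ℕ.+ α ℕ.+ (N ℕ.+ (Eβ ℕ.+ Eb′))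
      drop Eu El Eβ Eb′ α N eq h =
        ≤-by-≡ (((Eu ℕ.+ El) ℕ.+ El) ℕ.+ (α ℕ.+ N)) (((Eβ ℕ.+ Eb′) ℕ.+ Eβ) ℕ.+ (α ℕ.+ N))
          (ℕ-solve 6 (λ Eu El Eβ Eb′ α N → (Eu :+ α) :+ (El :+ El) :+ N
                                        := ((Eu :+ El) :+ El) :+ (α :+ N))
            refl Eu El Eβ Eb′ α N)
          (ℕ-solve 6 (λ Eu El Eβ Eb′ α N → Eβ :+ α :+ (N :+ (Eβ :+ Eb′))
                                        := ((Eβ :+ Eb′) :+ Eβ) :+ (α :+ N))
            refl Eu El Eβ Eb′ α N)
          (ℕP.+-monoˡ-≤ _ (ℕP.+-mono-≤ (ℕP.≤-reflexive eq) h))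
      rise : ∀ Eu El Eβ Eb′ α N → Eb′ ℕ.≤ Eu → N ℕ.≤ El →
              (Eβ ℕ.+ Eb′) ℕ.+ N ℕ.+ N ℕ.≤ Eβ ℕ.+ α ℕ.+ ((El ℕ.+ El) ℕ.+ (Eu ℕ.+ α))
      rise Eu El Eβ Eb′ α N h1 h2 with ℕP.m≤n⇒∃[o]m+o≡n h1 | ℕP.m≤n⇒∃[o]m+o≡n h2
      ... | k1 , refl | k2 , refl =
        ≤-of-≡+ (α ℕ.+ α ℕ.+ k2 ℕ.+ k2 ℕ.+ k1)
          (ℕ-solve 6 (λ Eβ Eb′ k1 N k2 α → Eβ :+ α :+ (((N :+ k2) :+ (N :+ k2)) :+ ((Eb′ :+ k1) :+ α))
                                        := ((Eβ :+ Eb′) :+ N :+ N) :+ (α :+ α :+ k2 :+ k2 :+ k1))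
            refl Eβ Eb′ k1 N k2 α)

    φ-lipschitz : Lipschitz φ
    φ-lipschitz = Lipschitzness.lipschitz (inj₂ refl) b′∈ wf g-far g-z g-between g-portal

  -- For h = 1, A is the first coordinate of the b′-portal if b′ < b, and N otherwise.
  module Side1 (i₀ j₀ b′ A : ℕ) (b′∈ : InRange N b′) (wf : WellFormed I)
               (i∈ : InRange χ i₀) (j∈ : InRange χ j₀)
               (A≤N : A ℕ.≤ N) (A-max : ∀ a → S i₀ j₀ a b′ → a ℕ.≤ A) where

    inRange : ∀ a b → S i₀ j₀ a b → InRange N a × InRange N b
    inRange a b ab∈S = wf i₀ j₀ a b i∈ j∈ ab∈S

    g₁ : ℕ → ℕ → ℚ
    g₁ a b with b ℕ.≤? b′
    ... | yes _ = ⟪ e b′ , a ⟫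
    ... | no _ = ⟪ e b ℕ.+ a , A ℕ.+ A ⟫

    g₁-≤ : ∀ a b → b ℕ.≤ b′ → g₁ a b ≡ ⟪ e b′ , a ⟫
    g₁-≤ a b b≤b′ with b ℕ.≤? b′
    ... | yes _ = refl
    ... | no b≰b′ = ⊥-elim (b≰b′ b≤b′)

    g₁-> : ∀ a b → b′ ℕ.< b → g₁ a b ≡ ⟪ e b ℕ.+ a , A ℕ.+ A ⟫
    g₁-> a b b′<b with b ℕ.≤? b′
    ... | yes b≤b′ = ⊥-elim (ℕP.<⇒≱ b′<b b≤b′)
    ... | no _ = refl

    open Potential i₀ j₀ 1 b′ g₁ public

    A+A≤e : ∀ {k} → 1 ℕ.≤ k → A ℕ.+ A ℕ.≤ e k
    A+A≤e 1≤k = ℕP.≤-trans (ℕP.+-mono-≤ A≤N A≤N) (N+N≤e 1≤k)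

    g-far : ∀ a b T → S i₀ j₀ a b → e N ℕ.+ e N ℕ.+ N ℕ.≤ T →
            ∣ g₁ a b - far ∣≤ ⟪ T , N ⟫ - ⟪ e b ℕ.+ a , N ⟫
    g-far a b T ab∈S hT with inRange a b ab∈S | ℕP.≤-<-connex b b′
    ... | (_ , a≤N) , (_ , b≤N) | inj₁ b≤b′ =
      ∣-∣≤-gap-by-ℕ (e b′) a (e N) 0 (e b ℕ.+ a) T (g₁-≤ a b b≤b′) refl
        (drop (e b′) (e b) (e N) a N T (e-mono-≤ (proj₂ b′∈)) (e-mono-≤ b≤N) hT)
        (rise (e b′) (e b) (e N) a N T (e-mono-≤ b≤N) a≤N (N≤e b′) hT)
      where
      drop : ∀ Eb′ Eb EN a N T → Eb′ ℕ.≤ EN → Eb ℕ.≤ EN → EN ℕ.+ EN ℕ.+ N ℕ.≤ T →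
               Eb′ ℕ.+ 0 ℕ.+ (N ℕ.+ (Eb ℕ.+ a)) ℕ.≤ T ℕ.+ N ℕ.+ (a ℕ.+ EN)
      drop Eb′ Eb EN a N T h1 h2 hT with ℕP.m≤n⇒∃[o]m+o≡n hT
      ... | t , refl =
        ≤-via-≡+ (EN ℕ.+ 0 ℕ.+ (N ℕ.+ (EN ℕ.+ a)))
          (ℕP.+-mono-≤ (ℕP.+-monoˡ-≤ 0 h1) (ℕP.+-monoʳ-≤ N (ℕP.+-monoˡ-≤ a h2))) (EN ℕ.+ N ℕ.+ t)
          (ℕ-solve 4 (λ EN N a t → (EN :+ EN :+ N :+ t) :+ N :+ (a :+ EN)
                                := (EN :+ con 0 :+ (N :+ (EN :+ a))) :+ (EN :+ N :+ t))
            refl EN N a t)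
      rise : ∀ Eb′ Eb EN a N T → Eb ℕ.≤ EN → a ℕ.≤ N → N ℕ.≤ Eb′ → EN ℕ.+ EN ℕ.+ N ℕ.≤ T →
               EN ℕ.+ a ℕ.+ (N ℕ.+ (Eb ℕ.+ a)) ℕ.≤ T ℕ.+ N ℕ.+ (0 ℕ.+ Eb′)
      rise Eb′ Eb EN a N T hb ha hb′ hT with ℕP.m≤n⇒∃[o]m+o≡n hb′
      ... | k , refl with ℕP.m≤n⇒∃[o]m+o≡n hT
      ... | t , refl =
        ≤-via-≡+ (EN ℕ.+ N ℕ.+ (N ℕ.+ (EN ℕ.+ N)))
          (ℕP.+-mono-≤ (ℕP.+-monoʳ-≤ EN ha) (ℕP.+-monoʳ-≤ N (ℕP.+-mono-≤ hb ha))) (t ℕ.+ k)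
          (ℕ-solve 4 (λ EN N k t → (EN :+ EN :+ N :+ t) :+ N :+ (con 0 :+ (N :+ k))
                                := (EN :+ N :+ (N :+ (EN :+ N))) :+ (t :+ k))
            refl EN N k t)

    ... | (_ , a≤N) , (_ , b≤N) | inj₂ b′<b =
      ∣-∣≤-gap-by-ℕ (e b ℕ.+ a) (A ℕ.+ A) (e N) 0 (e b ℕ.+ a) T (g₁-> a b b′<b) refl
        (drop (e b) (e N) a N A T (e-mono-≤ b≤N) a≤N (N≤e N) hT)
        (rise (e b) (e N) a N A T A≤N (N+N≤e {N} (s≤s z≤n)) hT)
      where
      drop : ∀ Eb EN a N A T → Eb ℕ.≤ EN → a ℕ.≤ N → N ℕ.≤ EN → EN ℕ.+ EN ℕ.+ N ℕ.≤ T →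
               Eb ℕ.+ a ℕ.+ 0 ℕ.+ (N ℕ.+ (Eb ℕ.+ a)) ℕ.≤ T ℕ.+ N ℕ.+ (A ℕ.+ A ℕ.+ EN)
      drop Eb EN a N A T hb ha hN hT with ℕP.m≤n⇒∃[o]m+o≡n hN
      ... | k , refl with ℕP.m≤n⇒∃[o]m+o≡n hT
      ... | t , refl =
        ≤-via-≡+ ((N ℕ.+ k) ℕ.+ N ℕ.+ 0 ℕ.+ (N ℕ.+ ((N ℕ.+ k) ℕ.+ N)))
          (ℕP.+-mono-≤ (ℕP.+-monoˡ-≤ 0 (ℕP.+-mono-≤ hb ha)) (ℕP.+-monoʳ-≤ N (ℕP.+-mono-≤ hb ha)))
          (k ℕ.+ t ℕ.+ A ℕ.+ A)
          (ℕ-solve 4 (λ N k t A → ((N :+ k) :+ (N :+ k) :+ N :+ t) :+ N :+ (A :+ A :+ (N :+ k))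
                               := ((N :+ k) :+ N :+ con 0 :+ (N :+ ((N :+ k) :+ N))) :+ (k :+ t :+ A :+ A))
            refl N k t A)
      rise : ∀ Eb EN a N A T → A ℕ.≤ N → N ℕ.+ N ℕ.≤ EN → EN ℕ.+ EN ℕ.+ N ℕ.≤ T →
               EN ℕ.+ (A ℕ.+ A) ℕ.+ (N ℕ.+ (Eb ℕ.+ a)) ℕ.≤ T ℕ.+ N ℕ.+ (0 ℕ.+ (Eb ℕ.+ a))
      rise Eb EN a N A T hA hN hT with ℕP.m≤n⇒∃[o]m+o≡n hN
      ... | k , refl with ℕP.m≤n⇒∃[o]m+o≡n hT
      ... | t , refl =
        ≤-via-≡+ ((N ℕ.+ N ℕ.+ k) ℕ.+ (N ℕ.+ N) ℕ.+ (N ℕ.+ (Eb ℕ.+ a)))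
          (ℕP.+-monoˡ-≤ (N ℕ.+ (Eb ℕ.+ a)) (ℕP.+-monoʳ-≤ EN (ℕP.+-mono-≤ hA hA))) (N ℕ.+ k ℕ.+ t)
          (ℕ-solve 5 (λ N k t Eb a → ((N :+ N :+ k) :+ (N :+ N :+ k) :+ N :+ t) :+ N :+ (con 0 :+ (Eb :+ a))
                                  := ((N :+ N :+ k) :+ (N :+ N) :+ (N :+ (Eb :+ a))) :+ (N :+ k :+ t))
            refl N k t Eb a)

    g-z : ∀ a b → S i₀ j₀ a b → ∣ zValue - g₁ a b ∣≤ ⟪ e b ℕ.+ a , N ⟫ - ⟪ N , N ⟫
    g-z a b ab∈S with inRange a b ab∈S | ℕP.≤-<-connex b b′
    ... | _ , (1≤b , _) | inj₁ b≤b′ =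
      ∣-∣≤-gap-by-ℕ (e b′) N (e b′) a N (e b ℕ.+ a) refl (g₁-≤ a b b≤b′)
        (drop (e b′) (e b) a N (N≤e b))
        (rise (e b′) (e b) a N (N+N≤e 1≤b))
      where
      drop : ∀ Eb′ Eb a N → N ℕ.≤ Eb → Eb′ ℕ.+ a ℕ.+ (N ℕ.+ N) ℕ.≤ Eb ℕ.+ a ℕ.+ N ℕ.+ (N ℕ.+ Eb′)
      drop Eb′ Eb a N h with ℕP.m≤n⇒∃[o]m+o≡n h
      ... | k , refl =
        ≤-of-≡+ (N ℕ.+ k)
          (ℕ-solve 4 (λ Eb′ N k a → (N :+ k) :+ a :+ N :+ (N :+ Eb′)
                                 := (Eb′ :+ a :+ (N :+ N)) :+ (N :+ k))
            refl Eb′ N k a)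
      rise : ∀ Eb′ Eb a N → N ℕ.+ N ℕ.≤ Eb → Eb′ ℕ.+ N ℕ.+ (N ℕ.+ N) ℕ.≤ Eb ℕ.+ a ℕ.+ N ℕ.+ (a ℕ.+ Eb′)
      rise Eb′ Eb a N h with ℕP.m≤n⇒∃[o]m+o≡n h
      ... | k , refl =
        ≤-of-≡+ (k ℕ.+ a ℕ.+ a)
          (ℕ-solve 4 (λ Eb′ N k a → (N :+ N :+ k) :+ a :+ N :+ (a :+ Eb′)
                                 := (Eb′ :+ N :+ (N :+ N)) :+ (k :+ a :+ a))
            refl Eb′ N k a)

    ... | _ , (1≤b , _) | inj₂ b′<b =
      ∣-∣≤-gap-by-ℕ (e b′) N (e b ℕ.+ a) (A ℕ.+ A) N (e b ℕ.+ a) refl (g₁-> a b b′<b)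
        (drop (e b′) (e b) a N A (e-mono-≤ (ℕP.<⇒≤ b′<b)) A≤N (N+N≤e 1≤b))
        (rise (e b′) (e b) a N A (N+N≤e (proj₁ b′∈)))
      where
      drop : ∀ Eb′ Eb a N A → Eb′ ℕ.≤ Eb → A ℕ.≤ N → N ℕ.+ N ℕ.≤ Eb →
               Eb′ ℕ.+ (A ℕ.+ A) ℕ.+ (N ℕ.+ N) ℕ.≤ Eb ℕ.+ a ℕ.+ N ℕ.+ (N ℕ.+ (Eb ℕ.+ a))
      drop Eb′ Eb a N A h1 hA h2 with ℕP.m≤n⇒∃[o]m+o≡n h2
      ... | k , refl =
        ≤-via-≡+ ((N ℕ.+ N ℕ.+ k) ℕ.+ (N ℕ.+ N) ℕ.+ (N ℕ.+ N))
          (ℕP.+-monoˡ-≤ (N ℕ.+ N) (ℕP.+-mono-≤ h1 (ℕP.+-mono-≤ hA hA))) (k ℕ.+ a ℕ.+ a)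
          (ℕ-solve 3 (λ N k a → (N :+ N :+ k) :+ a :+ N :+ (N :+ ((N :+ N :+ k) :+ a))
                             := ((N :+ N :+ k) :+ (N :+ N) :+ (N :+ N)) :+ (k :+ a :+ a))
            refl N k a)
      rise : ∀ Eb′ Eb a N A → N ℕ.+ N ℕ.≤ Eb′ →
        Eb ℕ.+ a ℕ.+ N ℕ.+ (N ℕ.+ N) ℕ.≤ Eb ℕ.+ a ℕ.+ N ℕ.+ (A ℕ.+ A ℕ.+ Eb′)
      rise Eb′ Eb a N A h with ℕP.m≤n⇒∃[o]m+o≡n h
      ... | k , refl =
        ≤-of-≡+ (A ℕ.+ A ℕ.+ k)
          (ℕ-solve 5 (λ Eb a N A k → Eb :+ a :+ N :+ (A :+ A :+ (N :+ N :+ k))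
                                  := (Eb :+ a :+ N :+ (N :+ N)) :+ (A :+ A :+ k))
            refl Eb a N A k)

    g-between : ∀ a₁ b₁ a₂ b₂ → S i₀ j₀ a₁ b₁ → S i₀ j₀ a₂ b₂ → e b₁ ℕ.+ a₁ ℕ.≤ e b₂ ℕ.+ a₂ →
                ∣ g₁ a₁ b₁ - g₁ a₂ b₂ ∣≤ ⟪ e b₂ ℕ.+ a₂ , N ⟫ - ⟪ e b₁ ℕ.+ a₁ , N ⟫
    g-between a₁ b₁ a₂ b₂ s₁ s₂ key₁≤key₂
      with inRange a₁ b₁ s₁ | inRange a₂ b₂ s₂ | ℕP.≤-<-connex b₁ b′ | ℕP.≤-<-connex b₂ b′
    ... | r₁ | r₂ | inj₁ b₁≤b′ | inj₁ b₂≤b′ =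
      ∣-∣≤-gap-by-ℕ (e b′) a₁ (e b′) a₂ (e b₁ ℕ.+ a₁) (e b₂ ℕ.+ a₂) (g₁-≤ a₁ b₁ b₁≤b′) (g₁-≤ a₂ b₂ b₂≤b′)
        (drop (e b′) (e b₁) a₁ (e b₂) a₂ N (e-mono-≤ (b≤ lex)))
        (rise (e b′) (e b₁) a₁ (e b₂) a₂ N (keys≤ lex))
      where
      lex : (b₁ ℕ.< b₂) ⊎ (b₁ ≡ b₂ × a₁ ℕ.≤ a₂)
      lex = e+-lex r₂ key₁≤key₂
      b≤ : (b₁ ℕ.< b₂) ⊎ (b₁ ≡ b₂ × a₁ ℕ.≤ a₂) → b₁ ℕ.≤ b₂
      b≤ (inj₁ b₁<b₂) = ℕP.<⇒≤ b₁<b₂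
      b≤ (inj₂ (refl , _)) = ℕP.≤-refl
      keys≤ : (b₁ ℕ.< b₂) ⊎ (b₁ ≡ b₂ × a₁ ℕ.≤ a₂) → e b₁ ℕ.+ a₁ ℕ.+ a₁ ℕ.≤ e b₂ ℕ.+ a₂ ℕ.+ a₂
      keys≤ (inj₁ b₁<b₂) = ℕP.≤-trans (e+a+a≤e (proj₂ (proj₁ r₁)) (proj₁ (proj₂ r₁)) b₁<b₂)
        (ℕP.≤-trans (ℕP.m≤m+n (e b₂) a₂) (ℕP.m≤m+n _ a₂))
      keys≤ (inj₂ (refl , a₁≤a₂)) = ℕP.+-mono-≤ (ℕP.+-monoʳ-≤ (e b₁) a₁≤a₂) a₁≤a₂
      drop : ∀ Eb′ Eb1 a1 Eb2 a2 N → Eb1 ℕ.≤ Eb2 →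
        Eb′ ℕ.+ a2 ℕ.+ (N ℕ.+ (Eb1 ℕ.+ a1)) ℕ.≤ Eb2 ℕ.+ a2 ℕ.+ N ℕ.+ (a1 ℕ.+ Eb′)
      drop Eb′ Eb1 a1 Eb2 a2 N h with ℕP.m≤n⇒∃[o]m+o≡n h
      ... | k , refl =
        ≤-of-≡+ k
          (ℕ-solve 6 (λ Eb′ Eb1 a1 a2 N k → (Eb1 :+ k) :+ a2 :+ N :+ (a1 :+ Eb′)
                                         := (Eb′ :+ a2 :+ (N :+ (Eb1 :+ a1))) :+ k)
            refl Eb′ Eb1 a1 a2 N k)
      rise : ∀ Eb′ Eb1 a1 Eb2 a2 N → Eb1 ℕ.+ a1 ℕ.+ a1 ℕ.≤ Eb2 ℕ.+ a2 ℕ.+ a2 →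
        Eb′ ℕ.+ a1 ℕ.+ (N ℕ.+ (Eb1 ℕ.+ a1)) ℕ.≤ Eb2 ℕ.+ a2 ℕ.+ N ℕ.+ (a2 ℕ.+ Eb′)
      rise Eb′ Eb1 a1 Eb2 a2 N h =
        ≤-by-≡ ((Eb1 ℕ.+ a1 ℕ.+ a1) ℕ.+ (Eb′ ℕ.+ N)) ((Eb2 ℕ.+ a2 ℕ.+ a2) ℕ.+ (Eb′ ℕ.+ N))
          (ℕ-solve 6 (λ Eb′ Eb1 a1 Eb2 a2 N → Eb′ :+ a1 :+ (N :+ (Eb1 :+ a1))
                                           := (Eb1 :+ a1 :+ a1) :+ (Eb′ :+ N))
            refl Eb′ Eb1 a1 Eb2 a2 N)
          (ℕ-solve 6 (λ Eb′ Eb1 a1 Eb2 a2 N → Eb2 :+ a2 :+ N :+ (a2 :+ Eb′)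
                                           := (Eb2 :+ a2 :+ a2) :+ (Eb′ :+ N))
            refl Eb′ Eb1 a1 Eb2 a2 N)
          (ℕP.+-monoˡ-≤ _ h)

    ... | r₁ | r₂ | inj₁ b₁≤b′ | inj₂ b′<b₂ =
      ∣-∣≤-gap-by-ℕ (e b′) a₁ (e b₂ ℕ.+ a₂) (A ℕ.+ A) (e b₁ ℕ.+ a₁) (e b₂ ℕ.+ a₂)
        (g₁-≤ a₁ b₁ b₁≤b′) (g₁-> a₂ b₂ b′<b₂)
        (drop (e b′) (e b₁) a₁ (e b₂) a₂ N A
          (ℕP.≤-trans (ℕP.+-monoʳ-≤ (e b′) (e-mono-≤ b₁≤b′)) (e-double-≤ b′<b₂)) (A+A≤e (proj₁ (proj₂ r₂))))
        (rise (e b′) (e b₁) a₁ (e b₂) a₂ N A (b₁-side (ℕP.m≤n⇒m<n∨m≡n b₁≤b′)))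
      where
      -- When b₁ = b′ this is where A bounds the first coordinates in row b′.
      b₁-side : (b₁ ℕ.< b′) ⊎ (b₁ ≡ b′) → e b₁ ℕ.+ a₁ ℕ.+ a₁ ℕ.≤ A ℕ.+ A ℕ.+ e b′
      b₁-side (inj₁ b₁<b′) = ℕP.≤-trans (e+a+a≤e (proj₂ (proj₁ r₁)) (proj₁ (proj₂ r₁)) b₁<b′)
        (ℕP.m≤n+m (e b′) (A ℕ.+ A))
      b₁-side (inj₂ refl) = ℕP.≤-trans (ℕP.+-mono-≤ (ℕP.+-monoʳ-≤ (e b₁) a₁≤A) a₁≤A)
        (ℕP.≤-reflexive (trans (ℕP.+-assoc (e b₁) A A) (ℕP.+-comm (e b₁) (A ℕ.+ A))))
        where
        a₁≤A : a₁ ℕ.≤ A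
        a₁≤A = A-max a₁ s₁
      drop : ∀ Eb′ Eb1 a1 Eb2 a2 N A → Eb′ ℕ.+ Eb1 ℕ.≤ Eb2 → A ℕ.+ A ℕ.≤ Eb2 →
                Eb′ ℕ.+ (A ℕ.+ A) ℕ.+ (N ℕ.+ (Eb1 ℕ.+ a1)) ℕ.≤ Eb2 ℕ.+ a2 ℕ.+ N ℕ.+ (a1 ℕ.+ (Eb2 ℕ.+ a2))
      drop Eb′ Eb1 a1 Eb2 a2 N A h1 h2 =
        ≤-by-≡ (((Eb′ ℕ.+ Eb1) ℕ.+ (A ℕ.+ A)) ℕ.+ (N ℕ.+ a1))
          (((Eb2 ℕ.+ Eb2) ℕ.+ (a2 ℕ.+ a2)) ℕ.+ (N ℕ.+ a1))
          (ℕ-solve 7 (λ Eb′ Eb1 a1 Eb2 a2 N A → Eb′ :+ (A :+ A) :+ (N :+ (Eb1 :+ a1))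
                                             := ((Eb′ :+ Eb1) :+ (A :+ A)) :+ (N :+ a1))
            refl Eb′ Eb1 a1 Eb2 a2 N A)
          (ℕ-solve 7 (λ Eb′ Eb1 a1 Eb2 a2 N A → Eb2 :+ a2 :+ N :+ (a1 :+ (Eb2 :+ a2))
                                             := ((Eb2 :+ Eb2) :+ (a2 :+ a2)) :+ (N :+ a1))
            refl Eb′ Eb1 a1 Eb2 a2 N A)
          (ℕP.+-monoˡ-≤ _ (ℕP.≤-trans (ℕP.+-mono-≤ h1 h2) (ℕP.m≤m+n _ _)))
      rise : ∀ Eb′ Eb1 a1 Eb2 a2 N A → Eb1 ℕ.+ a1 ℕ.+ a1 ℕ.≤ A ℕ.+ A ℕ.+ Eb′ →
                Eb2 ℕ.+ a2 ℕ.+ a1 ℕ.+ (N ℕ.+ (Eb1 ℕ.+ a1)) ℕ.≤ Eb2 ℕ.+ a2 ℕ.+ N ℕ.+ (A ℕ.+ A ℕ.+ Eb′)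
      rise Eb′ Eb1 a1 Eb2 a2 N A h =
        ≤-by-≡ ((Eb1 ℕ.+ a1 ℕ.+ a1) ℕ.+ (Eb2 ℕ.+ a2 ℕ.+ N))
          ((A ℕ.+ A ℕ.+ Eb′) ℕ.+ (Eb2 ℕ.+ a2 ℕ.+ N))
          (ℕ-solve 7 (λ Eb′ Eb1 a1 Eb2 a2 N A → Eb2 :+ a2 :+ a1 :+ (N :+ (Eb1 :+ a1))
                                             := (Eb1 :+ a1 :+ a1) :+ (Eb2 :+ a2 :+ N))
            refl Eb′ Eb1 a1 Eb2 a2 N A)
          (ℕ-solve 7 (λ Eb′ Eb1 a1 Eb2 a2 N A → Eb2 :+ a2 :+ N :+ (A :+ A :+ Eb′)
                                             := (A :+ A :+ Eb′) :+ (Eb2 :+ a2 :+ N))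
            refl Eb′ Eb1 a1 Eb2 a2 N A)
          (ℕP.+-monoˡ-≤ _ h)

    ... | _ | _ | inj₂ b′<b₁ | inj₁ b₂≤b′ = ⊥-elim (ℕP.<⇒≱ b′<b₁ (ℕP.≤-trans b₁≤b₂ b₂≤b′))
      where
      b₁≤b₂ : b₁ ℕ.≤ b₂
      b₁≤b₂ with e+-lex (inRange a₂ b₂ s₂) key₁≤key₂
      ... | inj₁ b₁<b₂ = ℕP.<⇒≤ b₁<b₂
      ... | inj₂ (refl , _) = ℕP.≤-refl
    ... | _ | _ | inj₂ b′<b₁ | inj₂ b′<b₂ =
      ∣-∣≤-gap-by-ℕ (e b₁ ℕ.+ a₁) (A ℕ.+ A) (e b₂ ℕ.+ a₂) (A ℕ.+ A) (e b₁ ℕ.+ a₁) (e b₂ ℕ.+ a₂)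
        (g₁-> a₁ b₁ b′<b₁) (g₁-> a₂ b₂ b′<b₂)
        (drop (e b₁) a₁ (e b₂) a₂ N A key₁≤key₂)
        (rise (e b₁) a₁ (e b₂) a₂ N A)
      where
      drop : ∀ Eb1 a1 Eb2 a2 N A → Eb1 ℕ.+ a1 ℕ.≤ Eb2 ℕ.+ a2 →
             Eb1 ℕ.+ a1 ℕ.+ (A ℕ.+ A) ℕ.+ (N ℕ.+ (Eb1 ℕ.+ a1)) ℕ.≤
             Eb2 ℕ.+ a2 ℕ.+ N ℕ.+ (A ℕ.+ A ℕ.+ (Eb2 ℕ.+ a2))
      drop Eb1 a1 Eb2 a2 N A h =
        ≤-by-≡ (((Eb1 ℕ.+ a1) ℕ.+ (Eb1 ℕ.+ a1)) ℕ.+ (A ℕ.+ A ℕ.+ N))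
          (((Eb2 ℕ.+ a2) ℕ.+ (Eb2 ℕ.+ a2)) ℕ.+ (A ℕ.+ A ℕ.+ N))
          (ℕ-solve 6 (λ Eb1 a1 Eb2 a2 N A → Eb1 :+ a1 :+ (A :+ A) :+ (N :+ (Eb1 :+ a1))
                                         := ((Eb1 :+ a1) :+ (Eb1 :+ a1)) :+ (A :+ A :+ N))
            refl Eb1 a1 Eb2 a2 N A)
          (ℕ-solve 6 (λ Eb1 a1 Eb2 a2 N A → Eb2 :+ a2 :+ N :+ (A :+ A :+ (Eb2 :+ a2))
                                         := ((Eb2 :+ a2) :+ (Eb2 :+ a2)) :+ (A :+ A :+ N))
            refl Eb1 a1 Eb2 a2 N A)
          (ℕP.+-monoˡ-≤ _ (ℕP.+-mono-≤ h h))
      rise : ∀ Eb1 a1 Eb2 a2 N A →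
        Eb2 ℕ.+ a2 ℕ.+ (A ℕ.+ A) ℕ.+ (N ℕ.+ (Eb1 ℕ.+ a1)) ℕ.≤ Eb2 ℕ.+ a2 ℕ.+ N ℕ.+ (A ℕ.+ A ℕ.+ (Eb1 ℕ.+ a1))
      rise Eb1 a1 Eb2 a2 N A =
        ≤-of-≡+ 0
          (ℕ-solve 6 (λ Eb1 a1 Eb2 a2 N A → Eb2 :+ a2 :+ N :+ (A :+ A :+ (Eb1 :+ a1))
                                         := (Eb2 :+ a2 :+ (A :+ A) :+ (N :+ (Eb1 :+ a1))) :+ con 0)
            refl Eb1 a1 Eb2 a2 N A)

    g-portal : ∀ β α → InRange N β → IsPortalA i₀ j₀ 1 β α → ∣ g₁ α β - uValue β ∣≤ portalLen 1 β α
    g-portal β α _ (inj₂ (() , _))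
    g-portal β α _ (inj₁ (_ , α∈S , _)) with inRange α β α∈S | ℕP.≤-<-connex β b′
    ... | (_ , α≤N) , _ | inj₁ β≤b′ =
      ∣-∣≤-by-ℕ (e b′) α (e β ℕ.+ e b′) (e (β ⊓ b′) ℕ.+ e (β ⊓ b′)) (e β) α
        (g₁-≤ α β β≤b′) refl (portalLen₁≡⟪⟫ β α) drop′ rise′
      where
      drop : ∀ Eb′ Eβ α → Eb′ ℕ.+ (Eβ ℕ.+ Eβ) ℕ.+ α ℕ.≤ Eβ ℕ.+ (α ℕ.+ (Eβ ℕ.+ Eb′))
      drop Eb′ Eβ α =
        ≤-of-≡+ 0
          (ℕ-solve 3 (λ Eb′ Eβ α → Eβ :+ (α :+ (Eβ :+ Eb′))
                                := (Eb′ :+ (Eβ :+ Eβ) :+ α) :+ con 0)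
            refl Eb′ Eβ α)
      rise : ∀ Eb′ Eβ α → α ℕ.≤ Eβ → Eβ ℕ.+ Eb′ ℕ.+ α ℕ.+ α ℕ.≤ Eβ ℕ.+ ((Eβ ℕ.+ Eβ) ℕ.+ Eb′)
      rise Eb′ Eβ α h with ℕP.m≤n⇒∃[o]m+o≡n h
      ... | k , refl =
        ≤-of-≡+ (k ℕ.+ k)
          (ℕ-solve 3 (λ Eb′ α k → (α :+ k) :+ (((α :+ k) :+ (α :+ k)) :+ Eb′)
                               := ((α :+ k) :+ Eb′ :+ α :+ α) :+ (k :+ k))
            refl Eb′ α k)

      drop′ : e b′ ℕ.+ (e (β ⊓ b′) ℕ.+ e (β ⊓ b′)) ℕ.+ α ℕ.≤ e β ℕ.+ (α ℕ.+ (e β ℕ.+ e b′))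
      drop′ rewrite ℕP.m≤n⇒m⊓n≡m β≤b′ = drop (e b′) (e β) α
      rise′ : e β ℕ.+ e b′ ℕ.+ α ℕ.+ α ℕ.≤ e β ℕ.+ ((e (β ⊓ b′) ℕ.+ e (β ⊓ b′)) ℕ.+ e b′)
      rise′ rewrite ℕP.m≤n⇒m⊓n≡m β≤b′ = rise (e b′) (e β) α (ℕP.≤-trans α≤N (N≤e β))
    ... | (_ , α≤N) , _ | inj₂ b′<β =
      ∣-∣≤-by-ℕ (e β ℕ.+ α) (A ℕ.+ A) (e β ℕ.+ e b′) (e (β ⊓ b′) ℕ.+ e (β ⊓ b′)) (e β) α
        (g₁-> α β b′<β) refl (portalLen₁≡⟪⟫ β α) drop′ rise′
      where
      drop : ∀ Eb′ Eβ α A → Eb′ ℕ.+ α ℕ.+ α ℕ.≤ Eβ →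
        Eβ ℕ.+ α ℕ.+ (Eb′ ℕ.+ Eb′) ℕ.+ α ℕ.≤ Eβ ℕ.+ (A ℕ.+ A ℕ.+ (Eβ ℕ.+ Eb′))
      drop Eb′ Eβ α A h with ℕP.m≤n⇒∃[o]m+o≡n h
      ... | k , refl =
        ≤-of-≡+ (A ℕ.+ A ℕ.+ k)
          (ℕ-solve 4 (λ Eb′ α A k → (Eb′ :+ α :+ α :+ k) :+ (A :+ A :+ ((Eb′ :+ α :+ α :+ k) :+ Eb′))
                                 := ((Eb′ :+ α :+ α :+ k) :+ α :+ (Eb′ :+ Eb′) :+ α) :+ (A :+ A :+ k))
            refl Eb′ α A k)
      rise : ∀ Eb′ Eβ α A → A ℕ.+ A ℕ.≤ Eb′ →
        Eβ ℕ.+ Eb′ ℕ.+ (A ℕ.+ A) ℕ.+ α ℕ.≤ Eβ ℕ.+ ((Eb′ ℕ.+ Eb′) ℕ.+ (Eβ ℕ.+ α))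
      rise Eb′ Eβ α A h with ℕP.m≤n⇒∃[o]m+o≡n h
      ... | k , refl =
        ≤-of-≡+ (k ℕ.+ Eβ)
          (ℕ-solve 4 (λ Eβ α A k → Eβ :+ (((A :+ A :+ k) :+ (A :+ A :+ k)) :+ (Eβ :+ α))
                                := (Eβ :+ (A :+ A :+ k) :+ (A :+ A) :+ α) :+ (k :+ Eβ))
            refl Eβ α A k)

      drop′ : e β ℕ.+ α ℕ.+ (e (β ⊓ b′) ℕ.+ e (β ⊓ b′)) ℕ.+ α ℕ.≤ e β ℕ.+ (A ℕ.+ A ℕ.+ (e β ℕ.+ e b′))
      drop′ rewrite ℕP.m≥n⇒m⊓n≡n (ℕP.<⇒≤ b′<β) = drop (e b′) (e β) α A (e+a+a≤e α≤N (proj₁ b′∈) b′<β)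
      rise′ : e β ℕ.+ e b′ ℕ.+ (A ℕ.+ A) ℕ.+ α ℕ.≤ e β ℕ.+ ((e (β ⊓ b′) ℕ.+ e (β ⊓ b′)) ℕ.+ (e β ℕ.+ α))
      rise′ rewrite ℕP.m≥n⇒m⊓n≡n (ℕP.<⇒≤ b′<β) = rise (e b′) (e β) α A (A+A≤e (proj₁ b′∈))

    φ-lipschitz : Lipschitz φ
    φ-lipschitz = Lipschitzness.lipschitz (inj₁ refl) b′∈ wf g-far g-z g-between g-portal

  e+α≤e+a : ∀ {α a β b} → α ℕ.≤ N → β ℕ.< b → e β ℕ.+ α ℕ.≤ e b ℕ.+ a
  e+α≤e+a {α} {a} {β} {b} α≤N β<b =
    ℕP.≤-trans (ℕP.+-monoʳ-≤ (e β) (ℕP.≤-trans α≤N (N≤e β))) (ℕP.≤-trans (e-double-≤ β<b) (ℕP.m≤m+n (e b) a))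

  shortest-3-≤ : WellFormed I → ∀ {i j a b b′} → InRange χ i → InRange χ j → S i j a b → InRange N b′ →
                 b ℕ.≤ b′ → PIsShortest i j 3 a b b′ b
  shortest-3-≤ wf i∈ j∈ ab∈S b′∈ b≤b′ α d₁ d₃ (inj₁ (() , _))
  shortest-3-≤ wf {i} {j} {a} {b} {b′} i∈ j∈ ab∈S b′∈ b≤b′ α d₁ d₃ port@(inj₂ (_ , α∈S , α-min)) =
    dist-through-edge φ φ-lipschitz (portal i∈ j∈ b∈ port)
      (¬¬-map reverseʷ (walk-between-v i∈ j∈ 3∈[4] α∈S ab∈S (ℕP.+-monoʳ-≤ (e b) (α-min a ab∈S))))
      (walk-up-U i∈ j∈ (inj₂ refl) (proj₁ b∈) b≤b′ (proj₂ b′∈))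
      (ℚP.≤-reflexive tight)
    where
    open Side3 i j b′ b′∈ wf i∈ j∈
    b∈ : InRange N b
    b∈ = proj₂ (inRange a b ab∈S)
    numerators : (e b ℕ.+ a ℕ.+ N) ℕ.+ (e b ℕ.+ α) ℕ.+ e b′ ℕ.+ (N ℕ.+ (e b′ ℕ.+ e b′)) ≡
                 (e (b′ ⊔ b) ℕ.+ a ℕ.+ (e (b′ ⊓ b′) ℕ.+ e (b′ ⊓ b′))) ℕ.+ ((N ℕ.+ (e b ℕ.+ α)) ℕ.+ N ℕ.+ e b)
    numerators rewrite ℕP.m≥n⇒m⊔n≡m b≤b′ | ℕP.⊓-idem b′ =
      ℕ-solve 5 (λ E E′ a α N → (E :+ a :+ N) :+ (E :+ α) :+ E′ :+ (N :+ (E′ :+ E′))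
                             := (E′ :+ a :+ (E′ :+ E′)) :+ ((N :+ (E :+ α)) :+ N :+ E))
        refl (e b) (e b′) a α N
    tight : (dpos a b - dpos α b) + portalLen 3 b α + ⟪ e b′ , e b ⟫ ≡ φ (v i j 3 a b) - φ (u i j 3 b′)
    tight = trans (⟪⟫-sum₃ (⟪⟫-difference (dpos≡⟪⟫ a b) (dpos≡⟪⟫ α b)) (portalLen₃≡⟪⟫ b α) refl)
      (trans (⟪⟫-cong numerators) (sym (⟪⟫-difference select-on select-on)))

  shortest-3-> : WellFormed I → ∀ {i j a b b′} → InRange χ i → InRange χ j → S i j a b → InRange N b′ →
                 b′ ℕ.< b → PIsShortest i j 3 a b b′ b′
  shortest-3-> wf i∈ j∈ ab∈S b′∈ b′<b α d₁ d₃ (inj₁ (() , _))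
  shortest-3-> wf {i} {j} {a} {b} {b′} i∈ j∈ ab∈S b′∈ b′<b α d₁ d₃ port@(inj₂ (_ , α∈S , _)) =
    dist-through-edge φ φ-lipschitz (portal i∈ j∈ b′∈ port)
      (¬¬-map reverseʷ (walk-between-v i∈ j∈ 3∈[4] α∈S ab∈S (e+α≤e+a α≤N b′<b)))
      nil
      (ℚP.≤-reflexive tight)
    where
    open Side3 i j b′ b′∈ wf i∈ j∈
    α≤N : α ℕ.≤ N
    α≤N = proj₂ (proj₁ (inRange α b′ α∈S))
    numerators : (e b ℕ.+ a ℕ.+ N) ℕ.+ (e b′ ℕ.+ α) ℕ.+ 0 ℕ.+ (N ℕ.+ (e b′ ℕ.+ e b′)) ≡
                 (e (b′ ⊔ b) ℕ.+ a ℕ.+ (e (b′ ⊓ b′) ℕ.+ e (b′ ⊓ b′))) ℕ.+ ((N ℕ.+ (e b′ ℕ.+ α)) ℕ.+ N ℕ.+ 0)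
    numerators rewrite ℕP.m≤n⇒m⊔n≡n (ℕP.<⇒≤ b′<b) | ℕP.⊓-idem b′ =
      ℕ-solve 5 (λ E E′ a α N → (E :+ a :+ N) :+ (E′ :+ α) :+ con 0 :+ (N :+ (E′ :+ E′))
                             := (E :+ a :+ (E′ :+ E′)) :+ ((N :+ (E′ :+ α)) :+ N :+ con 0))
        refl (e b) (e b′) a α N
    tight : (dpos a b - dpos α b′) + portalLen 3 b′ α + 0ℚ ≡ φ (v i j 3 a b) - φ (u i j 3 b′)
    tight = trans (⟪⟫-sum₃ (⟪⟫-difference (dpos≡⟪⟫ a b) (dpos≡⟪⟫ α b′)) (portalLen₃≡⟪⟫ b′ α) (0ℚ≡⟪⟫ 0))
      (trans (⟪⟫-cong numerators) (sym (⟪⟫-difference select-on select-on)))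

  shortest-1-≤ : WellFormed I → ∀ {i j a b b′} → InRange χ i → InRange χ j → S i j a b → InRange N b′ →
                 b ℕ.≤ b′ → PIsShortest i j 1 a b b′ b
  shortest-1-≤ wf i∈ j∈ ab∈S b′∈ b≤b′ α d₁ d₃ (inj₂ (() , _))
  shortest-1-≤ wf {i} {j} {a} {b} {b′} i∈ j∈ ab∈S b′∈ b≤b′ α d₁ d₃ port@(inj₁ (_ , α∈S , α-max)) =
    dist-through-edge φ φ-lipschitz (portal i∈ j∈ b∈ port)
      (walk-between-v i∈ j∈ 1∈[4] ab∈S α∈S (ℕP.+-monoʳ-≤ (e b) (α-max a ab∈S)))
      (walk-up-U i∈ j∈ (inj₁ refl) (proj₁ b∈) b≤b′ (proj₂ b′∈))
      (ℚP.≤-reflexive tight)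
    where
    open Side1 i j b′ N b′∈ wf i∈ j∈ ℕP.≤-refl (λ a′ a′∈S → proj₂ (proj₁ (wf i j a′ b′ i∈ j∈ a′∈S)))
    b∈ : InRange N b
    b∈ = proj₂ (inRange a b ab∈S)
    numerators : (e b ℕ.+ α ℕ.+ N) ℕ.+ e b ℕ.+ e b′ ℕ.+ (a ℕ.+ (e b′ ℕ.+ e b′)) ≡
                 (e b′ ℕ.+ (e (b′ ⊓ b′) ℕ.+ e (b′ ⊓ b′))) ℕ.+ ((N ℕ.+ (e b ℕ.+ a)) ℕ.+ α ℕ.+ e b)
    numerators rewrite ℕP.⊓-idem b′ =
      ℕ-solve 5 (λ E E′ a α N → (E :+ α :+ N) :+ E :+ E′ :+ (a :+ (E′ :+ E′))
                             := (E′ :+ (E′ :+ E′)) :+ ((N :+ (E :+ a)) :+ α :+ E))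
        refl (e b) (e b′) a α N
    tight : (dpos α b - dpos a b) + portalLen 1 b α + ⟪ e b′ , e b ⟫ ≡ φ (v i j 1 a b) - φ (u i j 1 b′)
    tight = trans (⟪⟫-sum₃ (⟪⟫-difference (dpos≡⟪⟫ α b) (dpos≡⟪⟫ a b)) (portalLen₁≡⟪⟫ b α) refl)
      (trans (⟪⟫-cong numerators) (sym (⟪⟫-difference (trans select-on (g₁-≤ a b b≤b′)) select-on)))

  shortest-1-> : WellFormed I → ∀ {i j a b b′} → InRange χ i → InRange χ j → S i j a b → InRange N b′ →
                 b′ ℕ.< b → PIsShortest i j 1 a b b′ b′
  shortest-1-> wf i∈ j∈ ab∈S b′∈ b′<b α d₁ d₃ (inj₂ (() , _))
  shortest-1-> wf {i} {j} {a} {b} {b′} i∈ j∈ ab∈S b′∈ b′<b α d₁ d₃ port@(inj₁ (_ , α∈S , α-max)) =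
    dist-through-edge φ φ-lipschitz (portal i∈ j∈ b′∈ port)
      (¬¬-map reverseʷ (walk-between-v i∈ j∈ 1∈[4] α∈S ab∈S (e+α≤e+a α≤N b′<b)))
      nil
      (ℚP.≤-reflexive tight)
    where
    α≤N : α ℕ.≤ N
    α≤N = proj₂ (proj₁ (wf i j α b′ i∈ j∈ α∈S))
    open Side1 i j b′ α b′∈ wf i∈ j∈ α≤N α-max
    numerators : (e b ℕ.+ a ℕ.+ N) ℕ.+ e b′ ℕ.+ 0 ℕ.+ (α ℕ.+ α ℕ.+ (e b′ ℕ.+ e b′)) ≡
                 (e b ℕ.+ a ℕ.+ (e (b′ ⊓ b′) ℕ.+ e (b′ ⊓ b′))) ℕ.+ ((N ℕ.+ (e b′ ℕ.+ α)) ℕ.+ α ℕ.+ 0)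
    numerators rewrite ℕP.⊓-idem b′ =
      ℕ-solve 5 (λ E E′ a α N → (E :+ a :+ N) :+ E′ :+ con 0 :+ (α :+ α :+ (E′ :+ E′))
                             := (E :+ a :+ (E′ :+ E′)) :+ ((N :+ (E′ :+ α)) :+ α :+ con 0))
        refl (e b) (e b′) a α N
    tight : (dpos a b - dpos α b′) + portalLen 1 b′ α + 0ℚ ≡ φ (v i j 1 a b) - φ (u i j 1 b′)
    tight = trans (⟪⟫-sum₃ (⟪⟫-difference (dpos≡⟪⟫ a b) (dpos≡⟪⟫ α b′)) (portalLen₁≡⟪⟫ b′ α) (0ℚ≡⟪⟫ 0))
      (trans (⟪⟫-cong numerators) (sym (⟪⟫-difference (trans select-on (g₁-> a b b′<b)) select-on)))

lemma5 : (I : GTInstance) → WellFormed I → StandingAssumption I →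
    (i j h a b b′ : ℕ) →
    InRange (GTInstance.χ I) i → InRange (GTInstance.χ I) j →
    (h ≡ 1 ⊎ h ≡ 3) → GTInstance.S I i j a b → InRange (GTInstance.n I) b′ →
    (b ℕ.≤ b′ → Graph.PIsShortest I i j h a b b′ b) ×
    (b′ ℕ.< b → Graph.PIsShortest I i j h a b b′ b′)
lemma5 record { n = zero } _ _ _ _ _ _ _ _ _ _ _ _ (1≤b′ , b′≤0) = ⊥-elim (ℕP.<⇒≱ 1≤b′ b′≤0)
lemma5 record { χ = χ ; n = suc m ; S = S } wf _ i j .1 a b b′ i∈ j∈ (inj₁ refl) ab∈S b′∈ =
  shortest-1-≤ wf i∈ j∈ ab∈S b′∈ , shortest-1-> wf i∈ j∈ ab∈S b′∈
  where open Gadget χ m S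
lemma5 record { χ = χ ; n = suc m ; S = S } wf _ i j .3 a b b′ i∈ j∈ (inj₂ refl) ab∈S b′∈ =
  shortest-3-≤ wf i∈ j∈ ab∈S b′∈ , shortest-3-> wf i∈ j∈ ab∈S b′∈
  where open Gadget χ m S
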